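{- Let $n\geq 5$ and let $\mathrm{GCA}(m)$, $m\geq 3$, be the lists of involutions of $\mathcal{S}_m$ defined below. If $\mathrm{GCA}(n-2)$ and $\mathrm{GCA}(n-1)$ each contain every involution of $\mathcal{S}_{n-2}$, resp. $\mathcal{S}_{n-1}$, exactly once and satisfy properties A1 and A2, then $\mathrm{GCA}(n)$ contains every involution of $\mathcal{S}_n$ exactly once, satisfies properties A1 and A2, and is cyclic (its first element is also obtained from its last element in the manner described in A2).
   Context: Permutations are written in one-line notation or in cycle notation; $\mathrm{id}$ is the identity. An involution over an alphabet $N$ of positive integers is an involutive permutation of $N$, written in one-line notation with positions indexed by $N$ in increasing order. List operations. For a list $L=(w_1,\dots,w_m)$ of involutions over $N$: $\overleftarrow{L}=(w_m,\dots,w_1)$; for $k\notin N$, $L\cdot k$ extends each $w_\ell$ to $N\cup\{k\}$ fixing $k$; for $i,j\notin N$, $L\cdot(i\,j)=(w_1(i\,j),\dots,w_m(i\,j))$, each $w_\ell$ composed with the disjoint transposition $(i\,j)$ over $N\cup\{i,j\}$. For an alphabet $N=\{a_1,\dots,a_r\}$ and bijection $F:[r]\to N$, $F(i)=a_i$, written $F=a_1a_2\cdots a_r$, and an involution $w$ of $[r]$, $w^F$ is the involution of $N$ with $w^F(F(i))=F(w(i))$ (so $(x\,y)\mapsto(a_x\,a_y)$); $L^F=(w_1^F,\dots,w_m^F)$, and $\overleftarrow{L}^F$ denotes the reversal of $L^F$. Concatenation of lists is written by juxtaposition. The lists $\mathrm{GCA}(m)$: $\mathrm{GCA}(3)=(\mathrm{id},(1\,2),(1\,3),(2\,3))$;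 $\mathrm{GCA}(4)=(\mathrm{id},(1\,3),(1\,3)(2\,4),(2\,4),(1\,4),(1\,4)(2\,3),(2\,3),(1\,2),(1\,2)(3\,4),(3\,4))$. For odd $n\geq5$: $\mathrm{GCA}(n)$ is the concatenation of $\mathrm{GCA}(n-1)^{F_0}\cdot n$ with $F_0=2\,3\cdots(n-1)\,1$, followed, for $i=1,2,\dots,\frac{n-1}{2}$ in order, by $\mathrm{GCA}(n-2)^{G_i}\cdot(2i-1\;n)$ and then $\overleftarrow{\mathrm{GCA}}(n-2)^{H_i}\cdot(2i\;n)$, where $G_i=(2i)\,1\,2\cdots(2i-2)\,(2i+1)\cdots(n-1)$ and $H_i=(2i-1)\,1\,2\cdots(2i-2)\,(2i+1)\cdots(n-1)$. For even $n\geq6$: $\mathrm{GCA}(n)$ is the concatenation of $\mathrm{GCA}(n-1)\cdot n$, then $\overleftarrow{\mathrm{GCA}}(n-2)^{F}\cdot(1\;n)$ with $F=2\,3\cdots(n-1)$, then, for $i=1,\dots,\frac n2-1$ in order, $\mathrm{GCA}(n-2)^{G_i}\cdot(2i\;n)$ followed by $\overleftarrow{\mathrm{GCA}}(n-2)^{H_i}\cdot(2i+1\;n)$, where $G_i=(2i+1)\,1\,2\cdots(2i-1)\,(2i+2)\cdots(n-1)$ and $H_i=(2i)\,1\,2\cdots(2i-1)\,(2i+2)\cdots(n-1)$. Property A1 (for a list of involutions of $[n]$): the first element is $\mathrm{id}$ and the last is $(n-1\;n)$. Property A2: each element is obtained from its predecessor, in one-line notation, either by exchanging the entries in two positions or by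 cyclically rotating the entries in three positions. -}

module Defs where

open import Data.Nat using (ℕ; zero; suc; _+_; _*_; _∸_; _≤_; _≡ᵇ_; ⌊_/2⌋)
open import Data.Bool using (Bool; true; false; if_then_else_)
open import Data.Maybe using (Maybe; just; nothing)
open import Data.List using (List; length; []; _∷_; _++_; map; reverse; upTo; concatMap; head; last)
open import Data.List.Relation.Unary.All using (All)
open import Data.List.Relation.Unary.Unique.Propositional using (Unique)
open import Data.List.Membership.Propositional using (_∈_)
open import Data.Product using (Σ; ∃; _×_; _,_)
open import Data.Sum using (_⊎_)
open import Data.Unit using (⊤)
open import Relation.Binary.PropositionalEquality using (_≡_; _≢_)
open import Function using (_∘_)

-- Involutions as functions ℕ → ℕ (fixing every point outside the
-- alphabet); converted to one-line notation at the end.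

Fun : Set
Fun = ℕ → ℕ

idF : Fun
idF x = x

tr : ℕ → ℕ → Fun
tr i j x = if x ≡ᵇ i then j else (if x ≡ᵇ j then i else x)

range : ℕ → ℕ → List ℕ
range a b = map (a +_) (upTo (suc b ∸ a))

-- 1-indexed lookup in a list (0 if out of range)
at : List ℕ → ℕ → ℕ
at []       _             = 0
at (x ∷ xs) zero          = 0
at (x ∷ xs) (suc zero)    = x
at (x ∷ xs) (suc (suc k)) = at xs (suc k)

indexOf : List ℕ → ℕ → Maybe ℕ
indexOf []       x = nothing
indexOf (y ∷ ys) x with x ≡ᵇ y
... | true  = just 1
... | false with indexOf ys x
...   | just k  = just (suc k)
...   | nothing = nothing

-- w ↦ w^F for F = a₁ a₂ ⋯ a_r (given as the list [a₁,…,a_r]):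
-- w^F(a_i) = a_{w(i)}, and w^F fixes all points outside {a₁,…,a_r}.
relabel : List ℕ → Fun → Fun
relabel F w x with indexOf F x
... | just i  = at F (w i)
... | nothing = x

dotK : ℕ → Fun → Fun
dotK k w x = if x ≡ᵇ k then k else w x

dot2 : ℕ → ℕ → Fun → Fun
dot2 i j w = w ∘ tr i j

gca3 : List Fun
gca3 = idF ∷ tr 1 2 ∷ tr 1 3 ∷ tr 2 3 ∷ []

gca4 : List Fun
gca4 = idF ∷ tr 1 3 ∷ (tr 1 3 ∘ tr 2 4) ∷ tr 2 4 ∷ tr 1 4 ∷ (tr 1 4 ∘ tr 2 3)
       ∷ tr 2 3 ∷ tr 1 2 ∷ (tr 1 2 ∘ tr 3 4) ∷ tr 3 4 ∷ []

isEven : ℕ → Bool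
isEven zero          = true
isEven (suc zero)    = false
isEven (suc (suc n)) = isEven n

-- odd n ≥ 5, A = GCA(n-1), B = GCA(n-2)
oddStep : ℕ → List Fun → List Fun → List Fun
oddStep n A B =
  map (dotK n ∘ relabel F₀) A
  ++ concatMap block (map suc (upTo ⌊ n /2⌋))
  where
    F₀ : List ℕ
    F₀ = range 2 (n ∸ 1) ++ (1 ∷ [])
    G : ℕ → List ℕ
    G i = (2 * i) ∷ (range 1 (2 * i ∸ 2) ++ range (2 * i + 1) (n ∸ 1))
    H : ℕ → List ℕ
    H i = (2 * i ∸ 1) ∷ (range 1 (2 * i ∸ 2) ++ range (2 * i + 1) (n ∸ 1))
    block : ℕ → List Fun
    block i = map (dot2 (2 * i ∸ 1) n ∘ relabel (G i)) B
              ++ reverse (map (dot2 (2 * i) n ∘ relabel (H i)) B)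

-- even n ≥ 6, A = GCA(n-1), B = GCA(n-2)
evenStep : ℕ → List Fun → List Fun → List Fun
evenStep n A B =
  map (dotK n) A
  ++ reverse (map (dot2 1 n ∘ relabel F) B)
  ++ concatMap block (map suc (upTo (⌊ n /2⌋ ∸ 1)))
  where
    F : List ℕ
    F = range 2 (n ∸ 1)
    G : ℕ → List ℕ
    G i = (2 * i + 1) ∷ (range 1 (2 * i ∸ 1) ++ range (2 * i + 2) (n ∸ 1))
    H : ℕ → List ℕ
    H i = (2 * i) ∷ (range 1 (2 * i ∸ 1) ++ range (2 * i + 2) (n ∸ 1))
    block : ℕ → List Fun
    block i = map (dot2 (2 * i) n ∘ relabel (G i)) B
              ++ reverse (map (dot2 (2 * i + 1) n ∘ relabel (H i)) B)

-- GCA(m) as functions (empty for m < 3, where it is undefined)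
gca : ℕ → List Fun
gca 0 = []
gca 1 = []
gca 2 = []
gca 3 = gca3
gca 4 = gca4
gca n@(suc m@(suc k@(suc (suc (suc _))))) =
  if isEven n then evenStep n (gca m) (gca k) else oddStep n (gca m) (gca k)

oneLine : ℕ → Fun → List ℕ
oneLine m w = map w (range 1 m)

GCA : ℕ → List (List ℕ)
GCA m = map (oneLine m) (gca m)

IsInvolution : ℕ → List ℕ → Set
IsInvolution m p =
  length p ≡ m ×
  (∀ i → 1 ≤ i → i ≤ m → (1 ≤ at p i) × (at p i ≤ m) × (at p (at p i) ≡ i))

ContainsEachInvolutionOnce : ℕ → List (List ℕ) → Set
ContainsEachInvolutionOnce m L =
  All (IsInvolution m) L × Unique L × (∀ p → IsInvolution m p → p ∈ L)

identity : ℕ → List ℕ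
identity m = range 1 m

lastTransp : ℕ → List ℕ
lastTransp m = range 1 (m ∸ 2) ++ (m ∷ (m ∸ 1) ∷ [])

A1 : ℕ → List (List ℕ) → Set
A1 m L = head L ≡ just (identity m) × last L ≡ just (lastTransp m)

SwapStep : ℕ → List ℕ → List ℕ → Set
SwapStep m u v = Σ ℕ λ a → Σ ℕ λ b →
  1 ≤ a × a ≤ m × 1 ≤ b × b ≤ m × a ≢ b ×
  at v a ≡ at u b × at v b ≡ at u a ×
  (∀ i → 1 ≤ i → i ≤ m → i ≢ a → i ≢ b → at v i ≡ at u i)

RotStep : ℕ → List ℕ → List ℕ → Set
RotStep m u v = Σ ℕ λ a → Σ ℕ λ b → Σ ℕ λ c →
  1 ≤ a × a ≤ m × 1 ≤ b × b ≤ m × 1 ≤ c × c ≤ m ×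
  a ≢ b × b ≢ c × a ≢ c ×
  at v a ≡ at u b × at v b ≡ at u c × at v c ≡ at u a ×
  (∀ i → 1 ≤ i → i ≤ m → i ≢ a → i ≢ b → i ≢ c → at v i ≡ at u i)

Step : ℕ → List ℕ → List ℕ → Set
Step m u v = SwapStep m u v ⊎ RotStep m u v

Adjacent : {A : Set} → (A → A → Set) → List A → Set
Adjacent R []           = ⊤
Adjacent R (x ∷ [])     = ⊤
Adjacent R (x ∷ y ∷ xs) = R x y × Adjacent R (y ∷ xs)

A2 : ℕ → List (List ℕ) → Set
A2 m L = Adjacent (Step m) L

Cyclic : ℕ → List (List ℕ) → Set
Cyclic m L = Σ (List ℕ) λ u → Σ (List ℕ) λ v →
  last L ≡ just u × head L ≡ just v × Step m u v

-- The involutions w of [1..n] are split by the value w(n). Those with w(n) = n are the involutions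
-- of [1..n-1] extended by the fixed point n (after the relabelling F₀ when n is odd), so GCA(n-1)
-- lists them. Those with w(n) = x < n are u ∘ (x n) for an involution u of the n-2 points other
-- than x and n, so a relabelled copy of GCA(n-2), read forwards or backwards, lists them.
-- Relabelling, fixing n and composing with (x n) turn exchanges and rotations of positions into
-- exchanges and rotations, so each part is a Gray code on its own; consecutive parts are joined by
-- one more exchange or rotation, mostly f ∘ (p n) ↦ f ∘ (p+1 n), a rotation of positions p, p+1, n.
module Submission where

open import Defs
open import Data.Nat using (ℕ; zero; suc; _+_; _*_; _∸_; _≤_; _<_; _≡ᵇ_; ⌊_/2⌋; z≤n; s≤s)
open import Data.Nat.Properties
open import Data.Bool using (true; false)
open import Data.Maybe using (just; nothing; fromMaybe)
open import Data.Maybe.Properties using (just-injective)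
import Data.Maybe
open import Data.List using (List; []; _∷_; _++_; length; map; reverse; upTo; applyUpTo; concatMap; head; last; [_])
open import Data.List.Properties
  using (length-map; length-applyUpTo; length-++; map-id; head-map; last-map; unfold-reverse; reverse-involutive;
         ++-identityʳ; map-applyUpTo)
open import Data.List.Relation.Unary.All as All using (All; []; _∷_)
import Data.List.Relation.Unary.All.Properties as All
open import Data.List.Relation.Unary.Any as Any using (Any; here; there)
import Data.List.Relation.Unary.Any.Properties as Any
open import Data.List.Relation.Unary.AllPairs as AllPairs using (AllPairs; []; _∷_)
import Data.List.Relation.Unary.AllPairs.Properties as AllPairs
open import Data.List.Relation.Unary.Unique.Propositional using (Unique)
open import Data.List.Membership.Propositional using (_∈_; _∉_)
open import Data.List.Membership.DecPropositional _≟_ using (_∈?_)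
open import Data.List.Membership.Propositional.Properties
  using (∈-map⁺; ∈-map⁻; ∈-upTo⁺; ∈-upTo⁻; ∈-++⁺ˡ; ∈-++⁺ʳ; ∈-++⁻)
import Data.List.Relation.Unary.Unique.Propositional.Properties as Unique
open import Data.Maybe.Relation.Unary.Any as Maybe using (just)
open import Data.Unit using (⊤; tt)
open import Data.Product using (Σ; _×_; _,_; proj₁; proj₂)
open import Data.Sum using (_⊎_; inj₁; inj₂)
import Data.Sum as Sum
open import Data.Empty using (⊥; ⊥-elim)
open import Relation.Nullary using (¬_; yes; no)
open import Relation.Nullary.Decidable using (dec-true; dec-false)
open import Relation.Binary.PropositionalEquality hiding ([_])
open import Function using (_∘_; id; case_of_)

private
  variable
    A B : Set

≤-suc-cases : ∀ {i m} → i ≤ suc m → i ≡ suc m ⊎ i ≤ m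
≤-suc-cases {m = m} i≤1+m with m≤n⇒m<n∨m≡n i≤1+m
... | inj₁ i<1+m = inj₂ (≤-pred i<1+m)
... | inj₂ i≡1+m = inj₁ i≡1+m

≤⇒≢suc : ∀ {i m} → i ≤ m → i ≢ suc m
≤⇒≢suc i≤m = <⇒≢ (s≤s i≤m)

-- x ≟ y decides via x ≡ᵇ y, so does (x ≟ y) is x ≡ᵇ y by definition.
≡ᵇ-refl : ∀ x → (x ≡ᵇ x) ≡ true
≡ᵇ-refl x = dec-true (x ≟ x) refl

≢⇒≡ᵇ-false : ∀ {x y} → x ≢ y → (x ≡ᵇ y) ≡ false
≢⇒≡ᵇ-false {x} {y} = dec-false (x ≟ y)

tr-left : ∀ a b → tr a b a ≡ b
tr-left a b rewrite ≡ᵇ-refl a = refl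

tr-right : ∀ a b → tr a b b ≡ a
tr-right a b with b ≟ a
... | yes refl = tr-left a a
... | no b≢a rewrite ≢⇒≡ᵇ-false b≢a | ≡ᵇ-refl b = refl

tr-other : ∀ {a b y} → y ≢ a → y ≢ b → tr a b y ≡ y
tr-other y≢a y≢b rewrite ≢⇒≡ᵇ-false y≢a | ≢⇒≡ᵇ-false y≢b = refl

tr-comm : ∀ a b y → tr a b y ≡ tr b a y
tr-comm a b y with y ≟ a | y ≟ b
... | yes refl | _        = trans (tr-left y b) (sym (tr-right b y))
... | no _     | yes refl = trans (tr-right a y) (sym (tr-left y a))
... | no y≢a   | no y≢b   = trans (tr-other y≢a y≢b) (sym (tr-other y≢b y≢a))

dotK-self : ∀ k w → dotK k w k ≡ k
dotK-self k w rewrite ≡ᵇ-refl k = refl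

dotK-other : ∀ {k y} w → y ≢ k → dotK k w y ≡ w y
dotK-other w y≢k rewrite ≢⇒≡ᵇ-false y≢k = refl

dotK-fixed : ∀ {k} w → w k ≡ k → ∀ y → dotK k w y ≡ w y
dotK-fixed {k} w wk≡k y with y ≟ k
... | yes refl = trans (dotK-self k w) (sym wk≡k)
... | no y≢k   = dotK-other w y≢k

-- Involutions of [1..m] and one-line notation

Agree : ℕ → Fun → Fun → Set
Agree m f g = ∀ i → 1 ≤ i → i ≤ m → f i ≡ g i

Agree-refl : ∀ {m f} → Agree m f f
Agree-refl _ _ _ = refl

Agree-sym : ∀ {m f g} → Agree m f g → Agree m g f
Agree-sym f≈g i 1≤i i≤m = sym (f≈g i 1≤i i≤m)

Agree-trans : ∀ {m f g h} → Agree m f g → Agree m g h → Agree m f h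
Agree-trans f≈g g≈h i 1≤i i≤m = trans (f≈g i 1≤i i≤m) (g≈h i 1≤i i≤m)

InvolutionOn : ℕ → Fun → Set
InvolutionOn m f = ∀ i → 1 ≤ i → i ≤ m → 1 ≤ f i × f i ≤ m × f (f i) ≡ i

InvolutionOn-cong : ∀ {m f g} → Agree m f g → InvolutionOn m f → InvolutionOn m g
InvolutionOn-cong {f = f} f≈g inv i 1≤i i≤m
  with 1≤fi , fi≤m , ffi≡i ← inv i 1≤i i≤m
  rewrite sym (f≈g i 1≤i i≤m) = 1≤fi , fi≤m , trans (sym (f≈g (f i) 1≤fi fi≤m)) ffi≡i

tr-involution : ∀ {n x y} → 1 ≤ x → x ≤ n → 1 ≤ y → y ≤ n → InvolutionOn n (tr x y)
tr-involution {x = x} {y} 1≤x x≤n 1≤y y≤n i 1≤i i≤n with i ≟ x | i ≟ y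
... | yes refl | _ rewrite tr-left i y = 1≤y , y≤n , tr-right i y
... | no _ | yes refl rewrite tr-right x i = 1≤x , x≤n , tr-left x i
... | no i≢x | no i≢y rewrite tr-other i≢x i≢y = 1≤i , i≤n , tr-other i≢x i≢y

at-map : ∀ (f : Fun) xs i → 1 ≤ i → i ≤ length xs → at (map f xs) i ≡ f (at xs i)
at-map f (x ∷ xs) 1             _ _         = refl
at-map f (x ∷ xs) (suc (suc i)) _ (s≤s i<) = at-map f xs (suc i) (s≤s z≤n) i<

at-applyUpTo : ∀ (f : Fun) m i → 1 ≤ i → i ≤ m → at (applyUpTo f m) i ≡ f (i ∸ 1)
at-applyUpTo f (suc m) 1             _ _         = refl
at-applyUpTo f (suc m) (suc (suc i)) _ (s≤s i<) = at-applyUpTo (f ∘ suc) m (suc i) (s≤s z≤n) i<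

at-++ˡ : ∀ xs ys i → 1 ≤ i → i ≤ length xs → at (xs ++ ys) i ≡ at xs i
at-++ˡ (x ∷ xs) ys 1             _ _         = refl
at-++ˡ (x ∷ xs) ys (suc (suc i)) _ (s≤s i<) = at-++ˡ xs ys (suc i) (s≤s z≤n) i<

at-++ʳ : ∀ xs ys i → 1 ≤ i → at (xs ++ ys) (length xs + i) ≡ at ys i
at-++ʳ []            ys i _   = refl
at-++ʳ (x ∷ [])      ys (suc i) _ = refl
at-++ʳ (x ∷ x′ ∷ xs) ys i 1≤i = at-++ʳ (x′ ∷ xs) ys i 1≤i

length-range : ∀ a b → length (range a b) ≡ suc b ∸ a
length-range a b = trans (length-map (a +_) (upTo (suc b ∸ a))) (length-applyUpTo id (suc b ∸ a))

at-range : ∀ a b i → 1 ≤ i → i ≤ suc b ∸ a → at (range a b) i ≡ a + (i ∸ 1)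
at-range a b i 1≤i i≤ = begin
  at (map (a +_) (upTo (suc b ∸ a))) i ≡⟨ at-map (a +_) (upTo (suc b ∸ a)) i 1≤i i≤|upTo| ⟩
  a + at (upTo (suc b ∸ a)) i          ≡⟨ cong (a +_) (at-applyUpTo id (suc b ∸ a) i 1≤i i≤) ⟩
  a + (i ∸ 1)                          ∎
  where
  open ≡-Reasoning
  i≤|upTo| : i ≤ length (upTo (suc b ∸ a))
  i≤|upTo| = subst (i ≤_) (sym (length-applyUpTo id (suc b ∸ a))) i≤

at-range1 : ∀ m i → 1 ≤ i → i ≤ m → at (range 1 m) i ≡ i
at-range1 m i 1≤i i≤m = trans (at-range 1 m i 1≤i i≤m) (m+[n∸m]≡n 1≤i)

length-oneLine : ∀ m f → length (oneLine m f) ≡ m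
length-oneLine m f = trans (length-map f (range 1 m)) (length-range 1 m)

at-oneLine : ∀ m f → Agree m (at (oneLine m f)) f
at-oneLine m f i 1≤i i≤m = begin
  at (map f (range 1 m)) i ≡⟨ at-map f (range 1 m) i 1≤i (subst (i ≤_) (sym (length-range 1 m)) i≤m) ⟩
  f (at (range 1 m) i)     ≡⟨ cong f (at-range1 m i 1≤i i≤m) ⟩
  f i                      ∎
  where open ≡-Reasoning

at-ext : ∀ m (p q : List ℕ) → length p ≡ m → length q ≡ m → Agree m (at p) (at q) → p ≡ q
at-ext zero    []      []      _     _     _   = refl
at-ext (suc m) (x ∷ p) (y ∷ q) |p|≡m |q|≡m p≈q =
  cong₂ _∷_ (p≈q 1 ≤-refl (s≤s z≤n))
    (at-ext m p q (suc-injective |p|≡m) (suc-injective |q|≡m)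
      λ { (suc i) _ i≤m → p≈q (suc (suc i)) (s≤s z≤n) (s≤s i≤m) })

oneLine-cong : ∀ {m f g} → Agree m f g → oneLine m f ≡ oneLine m g
oneLine-cong {m} {f} {g} f≈g = at-ext m _ _ (length-oneLine m f) (length-oneLine m g)
  (Agree-trans (at-oneLine m f) (Agree-trans f≈g (Agree-sym (at-oneLine m g))))

oneLine-injective : ∀ {m f g} → oneLine m f ≡ oneLine m g → Agree m f g
oneLine-injective {m} {f} {g} eq =
  Agree-trans (Agree-sym (at-oneLine m f)) (subst (λ p → Agree m (at p) g) (sym eq) (at-oneLine m g))

oneLine-at : ∀ {m p} → length p ≡ m → oneLine m (at p) ≡ p
oneLine-at {m} {p} |p|≡m = at-ext m _ _ (length-oneLine m (at p)) |p|≡m (at-oneLine m (at p))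

InvolutionOn⇒IsInvolution : ∀ {m f} → InvolutionOn m f → IsInvolution m (oneLine m f)
InvolutionOn⇒IsInvolution {m} {f} inv =
  length-oneLine m f , InvolutionOn-cong (Agree-sym (at-oneLine m f)) inv

-- Exchanges and rotations of positions

InImage : ℕ → Fun → ℕ → Set
InImage r e j = Σ ℕ λ i → 1 ≤ i × i ≤ r × e i ≡ j

SwapF : ℕ → Fun → Fun → Set
SwapF m u v = Σ ℕ λ a → Σ ℕ λ b →
  1 ≤ a × a ≤ m × 1 ≤ b × b ≤ m × a ≢ b ×
  v a ≡ u b × v b ≡ u a ×
  (∀ i → 1 ≤ i → i ≤ m → i ≢ a → i ≢ b → v i ≡ u i)

RotF : ℕ → Fun → Fun → Set
RotF m u v = Σ ℕ λ a → Σ ℕ λ b → Σ ℕ λ c →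
  1 ≤ a × a ≤ m × 1 ≤ b × b ≤ m × 1 ≤ c × c ≤ m ×
  a ≢ b × b ≢ c × a ≢ c ×
  v a ≡ u b × v b ≡ u c × v c ≡ u a ×
  (∀ i → 1 ≤ i → i ≤ m → i ≢ a → i ≢ b → i ≢ c → v i ≡ u i)

-- Step m u v is, by definition, StepF m (at u) (at v).
StepF : ℕ → Fun → Fun → Set
StepF m u v = SwapF m u v ⊎ RotF m u v

StepF-sym : ∀ {m f g} → StepF m f g → StepF m g f
StepF-sym (inj₁ (a , b , 1≤a , a≤m , 1≤b , b≤m , a≢b , ga , gb , rest)) =
  inj₁ (a , b , 1≤a , a≤m , 1≤b , b≤m , a≢b , sym gb , sym ga ,
        λ i 1≤i i≤m i≢a i≢b → sym (rest i 1≤i i≤m i≢a i≢b))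
StepF-sym (inj₂ (a , b , c , 1≤a , a≤m , 1≤b , b≤m , 1≤c , c≤m , a≢b , b≢c , a≢c , ga , gb , gc , rest)) =
  inj₂ (a , c , b , 1≤a , a≤m , 1≤c , c≤m , 1≤b , b≤m , a≢c , b≢c ∘ sym , a≢b , sym gc , sym gb , sym ga ,
        λ i 1≤i i≤m i≢a i≢c i≢b → sym (rest i 1≤i i≤m i≢a i≢b i≢c))

-- A step on [1..r] is carried along a position map e, injective on [1..r], and a value map c;
-- positions of [1..n] outside the image of e must be left unchanged.
StepF-transport : ∀ {r n f g f′ g′} (e c : Fun) →
  (∀ i → 1 ≤ i → i ≤ r → 1 ≤ e i × e i ≤ n) →
  (∀ {i j} → 1 ≤ i → i ≤ r → 1 ≤ j → j ≤ r → e i ≡ e j → i ≡ j) →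
  (∀ i → 1 ≤ i → i ≤ r → f′ (e i) ≡ c (f i)) →
  (∀ i → 1 ≤ i → i ≤ r → g′ (e i) ≡ c (g i)) →
  (∀ j → 1 ≤ j → j ≤ n → InImage r e j ⊎ g′ j ≡ f′ j) →
  StepF r f g → StepF n f′ g′
StepF-transport {r} {n} {f} {g} {f′} {g′} e c bound inj f′∘e g′∘e cover = λ where
    (inj₁ (a , b , 1≤a , a≤r , 1≤b , b≤r , a≢b , ga , gb , rest)) →
      inj₁ (e a , e b , 1≤e 1≤a a≤r , e≤n 1≤a a≤r , 1≤e 1≤b b≤r , e≤n 1≤b b≤r ,
            a≢b ∘ inj 1≤a a≤r 1≤b b≤r ,
            moved 1≤a a≤r 1≤b b≤r ga , moved 1≤b b≤r 1≤a a≤r gb ,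
            λ j 1≤j j≤n j≢a j≢b → unmoved j 1≤j j≤n λ i eᵢ≡j 1≤i i≤r →
              rest i 1≤i i≤r (λ { refl → j≢a (sym eᵢ≡j) }) (λ { refl → j≢b (sym eᵢ≡j) }))
    (inj₂ (a , b , d , 1≤a , a≤r , 1≤b , b≤r , 1≤d , d≤r , a≢b , b≢d , a≢d , ga , gb , gd , rest)) →
      inj₂ (e a , e b , e d ,
            1≤e 1≤a a≤r , e≤n 1≤a a≤r , 1≤e 1≤b b≤r , e≤n 1≤b b≤r , 1≤e 1≤d d≤r , e≤n 1≤d d≤r ,
            a≢b ∘ inj 1≤a a≤r 1≤b b≤r , b≢d ∘ inj 1≤b b≤r 1≤d d≤r , a≢d ∘ inj 1≤a a≤r 1≤d d≤r ,
            moved 1≤a a≤r 1≤b b≤r ga , moved 1≤b b≤r 1≤d d≤r gb , moved 1≤d d≤r 1≤a a≤r gd ,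
            λ j 1≤j j≤n j≢a j≢b j≢d → unmoved j 1≤j j≤n λ i eᵢ≡j 1≤i i≤r →
              rest i 1≤i i≤r (λ { refl → j≢a (sym eᵢ≡j) }) (λ { refl → j≢b (sym eᵢ≡j) })
                             (λ { refl → j≢d (sym eᵢ≡j) }))
  where
  1≤e : ∀ {i} → 1 ≤ i → i ≤ r → 1 ≤ e i
  1≤e 1≤i i≤r = proj₁ (bound _ 1≤i i≤r)
  e≤n : ∀ {i} → 1 ≤ i → i ≤ r → e i ≤ n
  e≤n 1≤i i≤r = proj₂ (bound _ 1≤i i≤r)
  moved : ∀ {a b} → 1 ≤ a → a ≤ r → 1 ≤ b → b ≤ r → g a ≡ f b → g′ (e a) ≡ f′ (e b)
  moved 1≤a a≤r 1≤b b≤r ga≡fb = trans (g′∘e _ 1≤a a≤r) (trans (cong c ga≡fb) (sym (f′∘e _ 1≤b b≤r)))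
  unmoved : ∀ j → 1 ≤ j → j ≤ n → (∀ i → e i ≡ j → 1 ≤ i → i ≤ r → g i ≡ f i) → g′ j ≡ f′ j
  unmoved j 1≤j j≤n fixed with cover j 1≤j j≤n
  ... | inj₁ (i , 1≤i , i≤r , refl) = moved 1≤i i≤r 1≤i i≤r (fixed i refl 1≤i i≤r)
  ... | inj₂ g′j≡f′j = g′j≡f′j

StepF-cong : ∀ {n f g f′ g′} → Agree n f f′ → Agree n g g′ → StepF n f g → StepF n f′ g′
StepF-cong f≈f′ g≈g′ = StepF-transport id id (λ _ 1≤i i≤n → 1≤i , i≤n) (λ _ _ _ _ eq → eq)
  (λ i 1≤i i≤n → sym (f≈f′ i 1≤i i≤n)) (λ i 1≤i i≤n → sym (g≈g′ i 1≤i i≤n))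
  (λ j 1≤j j≤n → inj₁ (j , 1≤j , j≤n , refl))

swap-step : ∀ {n} f {x y} → 1 ≤ x → x ≤ n → 1 ≤ y → y ≤ n → x ≢ y → StepF n f (f ∘ tr x y)
swap-step f {x} {y} 1≤x x≤n 1≤y y≤n x≢y =
  inj₁ (x , y , 1≤x , x≤n , 1≤y , y≤n , x≢y , cong f (tr-left x y) , cong f (tr-right x y) ,
        λ i _ _ i≢x i≢y → cong f (tr-other i≢x i≢y))

rotate-step : ∀ {n} f {p q c} → 1 ≤ p → p ≤ n → 1 ≤ q → q ≤ n → 1 ≤ c → c ≤ n →
  p ≢ q → p ≢ c → q ≢ c → StepF n (f ∘ tr p c) (f ∘ tr q c)
rotate-step f {p} {q} {c} 1≤p p≤n 1≤q q≤n 1≤c c≤n p≢q p≢c q≢c =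
  inj₂ (p , c , q , 1≤p , p≤n , 1≤c , c≤n , 1≤q , q≤n , p≢c , q≢c ∘ sym , p≢q ,
        cong f (trans (tr-other p≢q p≢c) (sym (tr-right p c))) ,
        cong f (trans (tr-right q c) (sym (tr-other (p≢q ∘ sym) q≢c))) ,
        cong f (trans (tr-left q c) (sym (tr-left p c))) ,
        λ i _ _ i≢p i≢c i≢q → cong f (trans (tr-other i≢q i≢c) (sym (tr-other i≢p i≢c))))

-- Segments of Gray codes

Any-just : ∀ {P : A → Set} {m x} → Maybe.Any P m → m ≡ just x → P x
Any-just (just px) refl = px

head-++⁺ : ∀ {P : A → Set} xs ys → Maybe.Any P (head xs) → Maybe.Any P (head (xs ++ ys))
head-++⁺ (x ∷ xs) ys px = px

last-++⁺ : ∀ {P : A → Set} xs ys → Maybe.Any P (last ys) → Maybe.Any P (last (xs ++ ys))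
last-++⁺ []            ys py = py
last-++⁺ (x ∷ [])      (y ∷ ys) py = py
last-++⁺ (x ∷ x′ ∷ xs) ys py = last-++⁺ (x′ ∷ xs) ys py

last-reverse : ∀ (xs : List A) → last (reverse xs) ≡ head xs
last-reverse []       = refl
last-reverse (x ∷ xs) = trans (cong last (unfold-reverse x xs)) (last-snoc (reverse xs))
  where
  last-snoc : ∀ ys → last (ys ++ [ x ]) ≡ just x
  last-snoc []            = refl
  last-snoc (y ∷ [])      = refl
  last-snoc (y ∷ y′ ∷ ys) = last-snoc (y′ ∷ ys)

head-reverse : ∀ (xs : List A) → head (reverse xs) ≡ last xs
head-reverse xs = trans (sym (last-reverse (reverse xs))) (cong last (reverse-involutive xs))

Adjacent-++ : ∀ {R : A → A → Set} xs ys → Adjacent R xs → Adjacent R ys →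
  (∀ {x y} → last xs ≡ just x → head ys ≡ just y → R x y) → Adjacent R (xs ++ ys)
Adjacent-++ []            ys       _          Rys _    = Rys
Adjacent-++ (x ∷ [])      []       _          _   _    = tt
Adjacent-++ (x ∷ [])      (y ∷ ys) _          Rys join = join refl refl , Rys
Adjacent-++ (x ∷ x′ ∷ xs) ys       (Rxx′ , Rxs) Rys join = Rxx′ , Adjacent-++ (x′ ∷ xs) ys Rxs Rys join

Adjacent-reverse : ∀ {R : A → A → Set} → (∀ {x y} → R x y → R y x) →
  ∀ xs → Adjacent R xs → Adjacent R (reverse xs)
Adjacent-reverse R-sym []           _          = tt
Adjacent-reverse R-sym (x ∷ [])     _          = tt
Adjacent-reverse {R = R} R-sym (x ∷ y ∷ xs) (Rxy , Rys) =
  subst (Adjacent R) (sym (unfold-reverse x (y ∷ xs)))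
    (Adjacent-++ (reverse (y ∷ xs)) [ x ] (Adjacent-reverse R-sym (y ∷ xs) Rys) tt join)
  where
  join : ∀ {u v} → last (reverse (y ∷ xs)) ≡ just u → just x ≡ just v → R u v
  join {u} {v} last≡u refl with trans (sym (last-reverse (y ∷ xs))) last≡u
  ... | refl = R-sym Rxy

Adjacent-map⁺ : ∀ {R : A → A → Set} {S : B → B → Set} (f : A → B) →
  (∀ {x y} → R x y → S (f x) (f y)) → ∀ xs → Adjacent R xs → Adjacent S (map f xs)
Adjacent-map⁺ f R⇒S []           _           = tt
Adjacent-map⁺ f R⇒S (x ∷ [])     _           = tt
Adjacent-map⁺ f R⇒S (x ∷ y ∷ xs) (Rxy , Rys) = R⇒S Rxy , Adjacent-map⁺ f R⇒S (y ∷ xs) Rys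

Adjacent-map⁻ : ∀ {R : A → A → Set} {S : B → B → Set} (f : A → B) →
  (∀ {x y} → S (f x) (f y) → R x y) → ∀ xs → Adjacent S (map f xs) → Adjacent R xs
Adjacent-map⁻ f S⇒R []           _           = tt
Adjacent-map⁻ f S⇒R (x ∷ [])     _           = tt
Adjacent-map⁻ f S⇒R (x ∷ y ∷ xs) (Sxy , Sys) = S⇒R Sxy , Adjacent-map⁻ f S⇒R (y ∷ xs) Sys

AllPairs-zipWith-All : ∀ {P : A → Set} {R S : A → A → Set} → (∀ {x y} → P x → P y → R x y → S x y) →
  ∀ {xs} → All P xs → AllPairs R xs → AllPairs S xs
AllPairs-zipWith-All R⇒S []         []          = []
AllPairs-zipWith-All R⇒S (px ∷ pxs) (Rx ∷ Rxs) =
  All.zipWith (λ (py , Rxy) → R⇒S px py Rxy) (pxs , Rx) ∷ AllPairs-zipWith-All R⇒S pxs Rxs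

All-reverse : ∀ {P : A → Set} {xs} → All P xs → All P (reverse xs)
All-reverse ps = All.tabulate (λ x∈ → All.lookup ps (Any.reverse⁻ x∈))

AllPairs-reverse : ∀ {R : A → A → Set} → (∀ {x y} → R x y → R y x) →
  ∀ {xs} → AllPairs R xs → AllPairs R (reverse xs)
AllPairs-reverse R-sym {[]}     []          = []
AllPairs-reverse {R = R} R-sym {x ∷ xs} (Rx ∷ Rxs) =
  subst (AllPairs R) (sym (unfold-reverse x xs))
    (AllPairs.++⁺ (AllPairs-reverse R-sym Rxs) ([] ∷ []) (All.map (λ Rxy → R-sym Rxy ∷ []) (All-reverse Rx)))

Distinct : ℕ → Fun → Fun → Set
Distinct n v w = ¬ Agree n v w

-- Entries are compared on [1..n] only; h and l are the first and last entries up to that agreement.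
record Segment (n : ℕ) (X : ℕ → Set) (L : List Fun) (h l : Fun) : Set where
  field
    involutions : All (InvolutionOn n) L
    distinct    : AllPairs (Distinct n) L
    steps       : Adjacent (StepF n) L
    values      : All (λ w → X (w n)) L
    complete    : ∀ v → InvolutionOn n v → X (v n) → Any (Agree n v) L
    starts      : Maybe.Any (Agree n h) (head L)
    ends        : Maybe.Any (Agree n l) (last L)

module _ {n : ℕ} {X : ℕ → Set} where

  Segment-reverse : ∀ {L h l} → Segment n X L h l → Segment n X (reverse L) l h
  Segment-reverse {L} seg = record
    { involutions = All-reverse involutions
    ; distinct    = AllPairs-reverse (λ v≉w → v≉w ∘ Agree-sym) distinct
    ; steps       = Adjacent-reverse StepF-sym L steps
    ; values      = All-reverse values
    ; complete    = λ v inv Xv → Any.reverse⁺ (complete v inv Xv)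
    ; starts      = subst (Maybe.Any _) (sym (head-reverse L)) ends
    ; ends        = subst (Maybe.Any _) (sym (last-reverse L)) starts
    }
    where open Segment seg

  Segment-endpoints : ∀ {L h l h′ l′} → Agree n h h′ → Agree n l l′ → Segment n X L h l → Segment n X L h′ l′
  Segment-endpoints h≈h′ l≈l′ seg = record
    { involutions = involutions
    ; distinct    = distinct
    ; steps       = steps
    ; values      = values
    ; complete    = complete
    ; starts      = Maybe.map (Agree-trans (Agree-sym h≈h′)) starts
    ; ends        = Maybe.map (Agree-trans (Agree-sym l≈l′)) ends
    }
    where open Segment seg

  Segment-values : ∀ {Y : ℕ → Set} {L h l} → 1 ≤ n →
    (∀ z → X z → Y z) → (∀ z → 1 ≤ z → z ≤ n → Y z → X z) → Segment n X L h l → Segment n Y L h l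
  Segment-values 1≤n X⇒Y Y⇒X seg = record
    { involutions = involutions
    ; distinct    = distinct
    ; steps       = steps
    ; values      = All.map (X⇒Y _) values
    ; complete    = λ v inv Yv → let 1≤v , v≤n , _ = inv n 1≤n ≤-refl in complete v inv (Y⇒X _ 1≤v v≤n Yv)
    ; starts      = starts
    ; ends        = ends
    }
    where open Segment seg

Segment-++ : ∀ {n X Y L M h l h′ l′} → 1 ≤ n → (∀ z → X z → ¬ Y z) → StepF n l h′ →
  Segment n X L h l → Segment n Y M h′ l′ → Segment n (λ z → X z ⊎ Y z) (L ++ M) h l′
Segment-++ {n} {Y = Y} {L} {M} 1≤n X⇒¬Y l→h′ segL segM = record
  { involutions = All.++⁺ L.involutions M.involutions
  ; distinct    = AllPairs.++⁺ L.distinct M.distinct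
                    (All.map (λ Xv → All.map (λ Yw v≈w → X⇒¬Y _ Xv (subst Y (sym (v≈w n 1≤n ≤-refl)) Yw)) M.values)
                             L.values)
  ; steps       = Adjacent-++ L M L.steps M.steps join
  ; values      = All.++⁺ (All.map inj₁ L.values) (All.map inj₂ M.values)
  ; complete    = λ where
                    v inv (inj₁ Xv) → Any.++⁺ˡ (L.complete v inv Xv)
                    v inv (inj₂ Yv) → Any.++⁺ʳ L (M.complete v inv Yv)
  ; starts      = head-++⁺ L M L.starts
  ; ends        = last-++⁺ L M M.ends
  }
  where
  module L = Segment segL
  module M = Segment segM
  join : ∀ {x y} → last L ≡ just x → head M ≡ just y → StepF n x y
  join lastL headM = StepF-cong (Any-just L.ends lastL) (Any-just M.starts headM) l→h′

GrayCode : ℕ → List Fun → Set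
GrayCode n L = Segment n (λ _ → ⊤) L idF (tr (n ∸ 1) n)

record Embedding (r n : ℕ) (C : Fun → Set) (T : Fun → Fun) : Set where
  field
    involution : ∀ {w} → InvolutionOn r w → InvolutionOn n (T w)
    satisfies  : ∀ w → C (T w)
    agree      : ∀ {w w′} → Agree r w w′ → Agree n (T w) (T w′)
    injective  : ∀ {w w′} → InvolutionOn r w → InvolutionOn r w′ → Agree n (T w) (T w′) → Agree r w w′
    step       : ∀ {w w′} → StepF r w w′ → StepF n (T w) (T w′)
    surjective : ∀ v → InvolutionOn n v → C v → Σ Fun λ w → InvolutionOn r w × Agree n (T w) v

Slice : ℕ → ℕ → ℕ → (Fun → Fun) → Set
Slice r n x = Embedding r n (λ v → v n ≡ x)

Segment-map : ∀ {r n x T B h l} → Slice r n x T → Segment r (λ _ → ⊤) B h l → Segment n (_≡ x) (map T B) (T h) (T l)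
Segment-map {r} {n} {x} {T} {B} slice seg = record
  { involutions = All.map⁺ (All.map involution S.involutions)
  ; distinct    = AllPairs.map⁺ (AllPairs-zipWith-All (λ inv inv′ w≉w′ → w≉w′ ∘ injective inv inv′)
                                                      S.involutions S.distinct)
  ; steps       = Adjacent-map⁺ T step B S.steps
  ; values      = All.map⁺ (All.map (λ {w} _ → satisfies w) S.involutions)
  ; complete    = complete
  ; starts      = subst (Maybe.Any _) (sym (head-map {f = T} B)) (map-end S.starts)
  ; ends        = subst (Maybe.Any _) (sym (last-map T B)) (map-end S.ends)
  }
  where
  open Embedding slice
  module S = Segment seg
  map-end : ∀ {u m} → Maybe.Any (Agree r u) m → Maybe.Any (Agree n (T u)) (Data.Maybe.map T m)
  map-end (just u≈w) = just (agree u≈w)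
  complete : ∀ v → InvolutionOn n v → v n ≡ x → Any (Agree n v) (map T B)
  complete v inv vn≡x with w , inv-w , Tw≈v ← surjective v inv vn≡x =
    Any.map⁺ (Any.map (λ w≈u → Agree-trans (Agree-sym Tw≈v) (agree w≈u)) (S.complete w inv-w tt))

-- Relabelling

at-∈ : ∀ F {k} → 1 ≤ k → k ≤ length F → at F k ∈ F
at-∈ (z ∷ zs) {1}           _ _        = here refl
at-∈ (z ∷ zs) {suc (suc k)} _ (s≤s k<) = there (at-∈ zs (s≤s z≤n) k<)

∈⇒at : ∀ {F y} → y ∈ F → InImage (length F) (at F) y
∈⇒at (here refl) = 1 , ≤-refl , s≤s z≤n , refl
∈⇒at (there y∈F) with ∈⇒at y∈F
... | suc k , _ , k≤ , at≡y = suc (suc k) , s≤s z≤n , s≤s k≤ , at≡y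

position : ∀ F y → InImage (length F) (at F) y ⊎ y ∉ F
position F y with y ∈? F
... | yes y∈F = inj₁ (∈⇒at y∈F)
... | no  y∉F = inj₂ y∉F

indexOf-∉ : ∀ F {y} → y ∉ F → indexOf F y ≡ nothing
indexOf-∉ []       _   = refl
indexOf-∉ (z ∷ zs) y∉ rewrite ≢⇒≡ᵇ-false (y∉ ∘ here) | indexOf-∉ zs (y∉ ∘ there) = refl

indexOf-at : ∀ {F} → Unique F → ∀ {k} → 1 ≤ k → k ≤ length F → indexOf F (at F k) ≡ just k
indexOf-at {z ∷ zs} _          {1}           _ _ rewrite ≡ᵇ-refl z = refl
indexOf-at {z ∷ zs} (z∉ ∷ uzs) {suc (suc k)} _ (s≤s k<)
  rewrite ≢⇒≡ᵇ-false (λ eq → All.lookup z∉ (at-∈ zs (s≤s z≤n) k<) (sym eq))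
        | indexOf-at uzs (s≤s z≤n) k< = refl

relabel-∉ : ∀ F w {y} → y ∉ F → relabel F w y ≡ y
relabel-∉ F w y∉F rewrite indexOf-∉ F y∉F = refl

module _ {F : List ℕ} (F-unique : Unique F) where

  relabel-at : ∀ w {k} → 1 ≤ k → k ≤ length F → relabel F w (at F k) ≡ at F (w k)
  relabel-at w 1≤k k≤ rewrite indexOf-at F-unique 1≤k k≤ = refl

  at-injective : ∀ {k k′} → 1 ≤ k → k ≤ length F → 1 ≤ k′ → k′ ≤ length F → at F k ≡ at F k′ → k ≡ k′
  at-injective {k} {k′} 1≤k k≤ 1≤k′ k′≤ eq = just-injective (begin
    just k                 ≡⟨ indexOf-at F-unique 1≤k k≤ ⟨
    indexOf F (at F k)     ≡⟨ cong (indexOf F) eq ⟩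
    indexOf F (at F k′)    ≡⟨ indexOf-at F-unique 1≤k′ k′≤ ⟩
    just k′                ∎)
    where open ≡-Reasoning

  relabel-id : ∀ y → relabel F idF y ≡ y
  relabel-id y with position F y
  ... | inj₁ (k , 1≤k , k≤ , refl) = relabel-at idF 1≤k k≤
  ... | inj₂ y∉F                   = relabel-∉ F idF y∉F

  relabel-tr : ∀ {a b} → 1 ≤ a → a ≤ length F → 1 ≤ b → b ≤ length F →
    ∀ y → relabel F (tr a b) y ≡ tr (at F a) (at F b) y
  relabel-tr {a} {b} 1≤a a≤ 1≤b b≤ y with position F y
  ... | inj₂ y∉F = trans (relabel-∉ F (tr a b) y∉F)
                     (sym (tr-other (λ { refl → y∉F (at-∈ F 1≤a a≤) }) (λ { refl → y∉F (at-∈ F 1≤b b≤) })))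
  ... | inj₁ (k , 1≤k , k≤ , refl) with k ≟ a | k ≟ b
  ...   | yes refl | _        =
    trans (relabel-at (tr k b) 1≤k k≤) (trans (cong (at F) (tr-left k b)) (sym (tr-left (at F k) (at F b))))
  ...   | no _     | yes refl =
    trans (relabel-at (tr a k) 1≤k k≤) (trans (cong (at F) (tr-right a k)) (sym (tr-right (at F a) (at F k))))
  ...   | no k≢a   | no k≢b   =
    trans (relabel-at (tr a b) 1≤k k≤)
      (trans (cong (at F) (tr-other k≢a k≢b))
        (sym (tr-other (k≢a ∘ at-injective 1≤k k≤ 1≤a a≤) (k≢b ∘ at-injective 1≤k k≤ 1≤b b≤))))

FixesOutside : ℕ → List ℕ → Fun → Set
FixesOutside m F v = ∀ y → 1 ≤ y → y ≤ m → y ∉ F → v y ≡ y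

module _ {m : ℕ} {F : List ℕ} (F-unique : Unique F) (F-bounded : ∀ {y} → y ∈ F → 1 ≤ y × y ≤ m) where

  private
    r : ℕ
    r = length F
    bounded : ∀ {k} → 1 ≤ k → k ≤ r → 1 ≤ at F k × at F k ≤ m
    bounded 1≤k k≤r = F-bounded (at-∈ F 1≤k k≤r)

  relabel-involution : ∀ {w} → InvolutionOn r w → InvolutionOn m (relabel F w)
  relabel-involution {w} inv i 1≤i i≤m with position F i
  ... | inj₂ i∉F rewrite relabel-∉ F w i∉F = 1≤i , i≤m , relabel-∉ F w i∉F
  ... | inj₁ (k , 1≤k , k≤r , refl) with 1≤wk , wk≤r , wwk≡k ← inv k 1≤k k≤r
        rewrite relabel-at F-unique w 1≤k k≤r =
          proj₁ (bounded 1≤wk wk≤r) , proj₂ (bounded 1≤wk wk≤r) ,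
          trans (relabel-at F-unique w 1≤wk wk≤r) (cong (at F) wwk≡k)

  relabel-agree : ∀ {w w′} → Agree r w w′ → Agree m (relabel F w) (relabel F w′)
  relabel-agree {w} {w′} w≈w′ i _ _ with position F i
  ... | inj₂ i∉F = trans (relabel-∉ F w i∉F) (sym (relabel-∉ F w′ i∉F))
  ... | inj₁ (k , 1≤k , k≤r , refl) = begin
    relabel F w (at F k)  ≡⟨ relabel-at F-unique w 1≤k k≤r ⟩
    at F (w k)            ≡⟨ cong (at F) (w≈w′ k 1≤k k≤r) ⟩
    at F (w′ k)           ≡⟨ relabel-at F-unique w′ 1≤k k≤r ⟨
    relabel F w′ (at F k) ∎
    where open ≡-Reasoning

  relabel-injective : ∀ {w w′} → InvolutionOn r w → InvolutionOn r w′ →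
    Agree m (relabel F w) (relabel F w′) → Agree r w w′
  relabel-injective {w} {w′} inv inv′ ρw≈ρw′ k 1≤k k≤r
    with 1≤wk , wk≤r , _ ← inv k 1≤k k≤r | 1≤w′k , w′k≤r , _ ← inv′ k 1≤k k≤r =
    at-injective F-unique 1≤wk wk≤r 1≤w′k w′k≤r (begin
      at F (w k)            ≡⟨ relabel-at F-unique w 1≤k k≤r ⟨
      relabel F w (at F k)  ≡⟨ ρw≈ρw′ (at F k) (proj₁ (bounded 1≤k k≤r)) (proj₂ (bounded 1≤k k≤r)) ⟩
      relabel F w′ (at F k) ≡⟨ relabel-at F-unique w′ 1≤k k≤r ⟩
      at F (w′ k)           ∎)
    where open ≡-Reasoning

  relabel-step : ∀ {w w′} → StepF r w w′ → StepF m (relabel F w) (relabel F w′)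
  relabel-step {w} {w′} = StepF-transport (at F) (at F) (λ _ → bounded) (at-injective F-unique)
    (λ _ → relabel-at F-unique w) (λ _ → relabel-at F-unique w′) unchanged-outside
    where
    unchanged-outside : ∀ j → 1 ≤ j → j ≤ m → InImage r (at F) j ⊎ relabel F w′ j ≡ relabel F w j
    unchanged-outside j _ _ with position F j
    ... | inj₁ found = inj₁ found
    ... | inj₂ j∉F   = inj₂ (trans (relabel-∉ F w′ j∉F) (sym (relabel-∉ F w j∉F)))

  relabel-surjective : ∀ v → InvolutionOn m v → FixesOutside m F v →
    Σ Fun λ w → InvolutionOn r w × Agree m (relabel F w) v
  relabel-surjective v inv fixes = w , w-involution , w-agree
    where
    w : Fun
    w k = fromMaybe 0 (indexOf F (v (at F k)))
    -- v maps F into F: a point outside F would be fixed by v, hence equal to its preimage.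
    image : ∀ {k} → 1 ≤ k → k ≤ r → Σ ℕ λ j → 1 ≤ j × j ≤ r × at F j ≡ v (at F k) × w k ≡ j
    image {k} 1≤k k≤r with position F (v (at F k))
    ... | inj₁ (j , 1≤j , j≤r , at≡) =
          j , 1≤j , j≤r , at≡ ,
          cong (fromMaybe 0) (trans (cong (indexOf F) (sym at≡)) (indexOf-at F-unique 1≤j j≤r))
    ... | inj₂ v∉F with 1≤v , v≤m , vv≡ ← inv (at F k) (proj₁ (bounded 1≤k k≤r)) (proj₂ (bounded 1≤k k≤r)) =
          ⊥-elim (v∉F (subst (_∈ F) (trans (sym vv≡) (fixes _ 1≤v v≤m v∉F)) (at-∈ F 1≤k k≤r)))
    w-involution : InvolutionOn r w
    w-involution k 1≤k k≤r with image 1≤k k≤r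
    ... | j , 1≤j , j≤r , atj≡ , wk≡j with image 1≤j j≤r
    ...   | j′ , 1≤j′ , j′≤r , atj′≡ , wj≡j′ rewrite wk≡j =
            1≤j , j≤r , trans wj≡j′ (at-injective F-unique 1≤j′ j′≤r 1≤k k≤r (begin
              at F j′         ≡⟨ atj′≡ ⟩
              v (at F j)      ≡⟨ cong v atj≡ ⟩
              v (v (at F k))  ≡⟨ proj₂ (proj₂ (inv _ (proj₁ (bounded 1≤k k≤r)) (proj₂ (bounded 1≤k k≤r)))) ⟩
              at F k          ∎))
      where open ≡-Reasoning
    w-agree : Agree m (relabel F w) v
    w-agree i 1≤i i≤m with position F i
    ... | inj₂ i∉F = trans (relabel-∉ F w i∉F) (sym (fixes i 1≤i i≤m i∉F))
    ... | inj₁ (k , 1≤k , k≤r , refl) with j , _ , _ , atj≡ , wk≡j ← image 1≤k k≤r =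
          trans (relabel-at F-unique w 1≤k k≤r) (trans (cong (at F) wk≡j) atj≡)

  relabel-embedding : Embedding r m (FixesOutside m F) (relabel F)
  relabel-embedding = record
    { involution = relabel-involution
    ; satisfies  = λ w y _ _ y∉F → relabel-∉ F w y∉F
    ; agree      = relabel-agree
    ; injective  = relabel-injective
    ; step       = relabel-step
    ; surjective = relabel-surjective
    }

Embedding-restrict : ∀ {r n C C′ T} → (∀ w → C′ (T w)) → (∀ {v} → InvolutionOn n v → C′ v → C v) →
  Embedding r n C T → Embedding r n C′ T
Embedding-restrict C′-holds C′⇒C emb = record
  { involution = involution
  ; satisfies  = C′-holds
  ; agree      = agree
  ; injective  = injective
  ; step       = step
  ; surjective = λ v inv C′v → surjective v inv (C′⇒C inv C′v)
  }
  where open Embedding emb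

id-embedding : ∀ {m} → Embedding m m (λ _ → ⊤) id
id-embedding = record
  { involution = id
  ; satisfies  = λ _ → tt
  ; agree      = id
  ; injective  = λ _ _ → id
  ; step       = id
  ; surjective = λ v inv _ → v , inv , Agree-refl
  }

fixLast-slice : ∀ {r m ρ} → Embedding r m (λ _ → ⊤) ρ → Slice r (suc m) (suc m) (λ w → dotK (suc m) (ρ w))
fixLast-slice {r} {m} {ρ} emb = record
  { involution = involution
  ; satisfies  = λ w → dotK-self n (ρ w)
  ; agree      = agree
  ; injective  = λ {w} {w′} inv inv′ Tw≈Tw′ → E.injective inv inv′ λ i 1≤i i≤m →
                   trans (sym (below w i≤m)) (trans (Tw≈Tw′ i 1≤i (m≤n⇒m≤1+n i≤m)) (below w′ i≤m))
  ; step       = λ {w} {w′} st → StepF-transport id id (λ _ 1≤i i≤m → 1≤i , m≤n⇒m≤1+n i≤m)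
                   (λ _ _ _ _ eq → eq) (λ _ _ → below w) (λ _ _ → below w′) (top-unchanged w w′) (E.step st)
  ; surjective = surjective
  }
  where
  module E = Embedding emb
  n : ℕ
  n = suc m
  below : ∀ w {i} → i ≤ m → dotK n (ρ w) i ≡ ρ w i
  below w i≤m = dotK-other (ρ w) (≤⇒≢suc i≤m)
  involution : ∀ {w} → InvolutionOn r w → InvolutionOn n (dotK n (ρ w))
  involution {w} inv i 1≤i i≤n with ≤-suc-cases i≤n
  ... | inj₁ refl rewrite dotK-self n (ρ w) = 1≤i , ≤-refl , dotK-self n (ρ w)
  ... | inj₂ i≤m with 1≤ρi , ρi≤m , ρρi≡i ← E.involution inv i 1≤i i≤m rewrite below w i≤m =
        1≤ρi , m≤n⇒m≤1+n ρi≤m , trans (below w ρi≤m) ρρi≡i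
  agree : ∀ {w w′} → Agree r w w′ → Agree n (dotK n (ρ w)) (dotK n (ρ w′))
  agree {w} {w′} w≈w′ i 1≤i i≤n with ≤-suc-cases i≤n
  ... | inj₁ refl = trans (dotK-self n (ρ w)) (sym (dotK-self n (ρ w′)))
  ... | inj₂ i≤m  = trans (below w i≤m) (trans (E.agree w≈w′ i 1≤i i≤m) (sym (below w′ i≤m)))
  top-unchanged : ∀ w w′ j → 1 ≤ j → j ≤ n → InImage m id j ⊎ dotK n (ρ w′) j ≡ dotK n (ρ w) j
  top-unchanged w w′ j 1≤j j≤n with ≤-suc-cases j≤n
  ... | inj₁ refl = inj₂ (trans (dotK-self n (ρ w′)) (sym (dotK-self n (ρ w))))
  ... | inj₂ j≤m  = inj₁ (j , 1≤j , j≤m , refl)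
  surjective : ∀ v → InvolutionOn n v → v n ≡ n → Σ Fun λ w → InvolutionOn r w × Agree n (dotK n (ρ w)) v
  surjective v inv vn≡n with E.surjective v inv-below tt
    where
    inv-below : InvolutionOn m v
    inv-below i 1≤i i≤m with 1≤vi , vi≤n , vvi≡i ← inv i 1≤i (m≤n⇒m≤1+n i≤m) with ≤-suc-cases vi≤n
    ... | inj₁ vi≡n = ⊥-elim (≤⇒≢suc i≤m (trans (sym vvi≡i) (trans (cong v vi≡n) vn≡n)))
    ... | inj₂ vi≤m = 1≤vi , vi≤m , vvi≡i
  ... | w , inv-w , ρw≈v = w , inv-w , λ i 1≤i i≤n → case-top i 1≤i i≤n
    where
    case-top : ∀ i → 1 ≤ i → i ≤ n → dotK n (ρ w) i ≡ v i
    case-top i 1≤i i≤n with ≤-suc-cases i≤n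
    ... | inj₁ refl = trans (dotK-self n (ρ w)) (sym vn≡n)
    ... | inj₂ i≤m  = trans (below w i≤m) (ρw≈v i 1≤i i≤m)

∘-involution : ∀ {n u t} → InvolutionOn n u → InvolutionOn n t →
  (∀ i → 1 ≤ i → i ≤ n → u (t i) ≡ t (u i)) → InvolutionOn n (u ∘ t)
∘-involution {u = u} {t} inv-u inv-t comm i 1≤i i≤n
  with 1≤ti , ti≤n , tti≡i ← inv-t i 1≤i i≤n
  with 1≤uti , uti≤n , _ ← inv-u (t i) 1≤ti ti≤n =
  1≤uti , uti≤n , (begin
    u (t (u (t i)))  ≡⟨ cong u (comm (t i) 1≤ti ti≤n) ⟨
    u (u (t (t i)))  ≡⟨ cong (u ∘ u) tti≡i ⟩
    u (u i)          ≡⟨ proj₂ (proj₂ (inv-u i 1≤i i≤n)) ⟩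
    i                ∎)
  where open ≡-Reasoning

tr-commute : ∀ {n u x y} → InvolutionOn n u → (u x ≡ x × u y ≡ y) ⊎ (u x ≡ y × u y ≡ x) →
  ∀ i → 1 ≤ i → i ≤ n → u (tr x y i) ≡ tr x y (u i)
tr-commute {u = u} {x} {y} inv pair i 1≤i i≤n with i ≟ x | i ≟ y
... | yes refl | _ with pair
...   | inj₁ (ux≡x , uy≡y) rewrite tr-left i y | ux≡x | uy≡y | tr-left i y = refl
...   | inj₂ (ux≡y , uy≡x) rewrite tr-left i y | ux≡y | uy≡x | tr-right i y = refl
tr-commute {u = u} {x} {y} inv pair i 1≤i i≤n | no _ | yes refl with pair
...   | inj₁ (ux≡x , uy≡y) rewrite tr-right x i | ux≡x | uy≡y | tr-right x i = refl
...   | inj₂ (ux≡y , uy≡x) rewrite tr-right x i | ux≡y | uy≡x | tr-left x i = refl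
tr-commute {u = u} {x} {y} inv pair i 1≤i i≤n | no i≢x | no i≢y =
  trans (cong u (tr-other i≢x i≢y)) (sym (tr-other (outside pair ∘ inj₁) (outside pair ∘ inj₂)))
  where
  uui≡i : u (u i) ≡ i
  uui≡i = proj₂ (proj₂ (inv i 1≤i i≤n))
  back : ∀ {z z′} → u i ≡ z → u z ≡ z′ → i ≡ z′
  back ui≡z uz≡z′ = trans (sym uui≡i) (trans (cong u ui≡z) uz≡z′)
  outside : (u x ≡ x × u y ≡ y) ⊎ (u x ≡ y × u y ≡ x) → u i ≡ x ⊎ u i ≡ y → ⊥
  outside (inj₁ (ux≡x , _))   (inj₁ ui≡x) = i≢x (back ui≡x ux≡x)
  outside (inj₁ (_ , uy≡y))   (inj₂ ui≡y) = i≢y (back ui≡y uy≡y)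
  outside (inj₂ (ux≡y , _))   (inj₁ ui≡x) = i≢y (back ui≡x ux≡y)
  outside (inj₂ (_ , uy≡x))   (inj₂ ui≡y) = i≢x (back ui≡y uy≡x)

swapLast-slice : ∀ {r n x ρ} → 1 ≤ x → x < n → Embedding r n (λ v → v x ≡ x × v n ≡ n) ρ →
  Slice r n x (λ w → dot2 x n (ρ w))
swapLast-slice {r} {n} {x} {ρ} 1≤x x<n emb = record
  { involution = λ {w} inv → ∘-involution (E.involution inv) t-involution
                               (tr-commute (E.involution inv) (inj₁ (E.satisfies w)))
  ; satisfies  = λ w → trans (cong (ρ w) (tr-right x n)) (proj₁ (E.satisfies w))
  ; agree      = λ w≈w′ i 1≤i i≤n → E.agree w≈w′ (t i) (1≤t 1≤i i≤n) (t≤n 1≤i i≤n)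
  ; injective  = λ {w} {w′} inv inv′ ρw∘t≈ρw′∘t → E.injective inv inv′ λ i 1≤i i≤n → begin
                   ρ w i          ≡⟨ cong (ρ w) (t∘t 1≤i i≤n) ⟨
                   ρ w (t (t i))  ≡⟨ ρw∘t≈ρw′∘t (t i) (1≤t 1≤i i≤n) (t≤n 1≤i i≤n) ⟩
                   ρ w′ (t (t i)) ≡⟨ cong (ρ w′) (t∘t 1≤i i≤n) ⟩
                   ρ w′ i         ∎
  ; step       = λ {w} {w′} st → StepF-transport t id (λ _ 1≤i i≤n → 1≤t 1≤i i≤n , t≤n 1≤i i≤n)
                   (λ 1≤i i≤n 1≤j j≤n ti≡tj →
                      trans (sym (t∘t 1≤i i≤n)) (trans (cong t ti≡tj) (t∘t 1≤j j≤n)))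
                   (λ _ 1≤i i≤n → cong (ρ w) (t∘t 1≤i i≤n)) (λ _ 1≤i i≤n → cong (ρ w′) (t∘t 1≤i i≤n))
                   (λ j 1≤j j≤n → inj₁ (t j , 1≤t 1≤j j≤n , t≤n 1≤j j≤n , t∘t 1≤j j≤n)) (E.step st)
  ; surjective = surjective
  }
  where
  open ≡-Reasoning
  module E = Embedding emb
  t : Fun
  t = tr x n
  1≤n : 1 ≤ n
  1≤n = ≤-trans 1≤x (<⇒≤ x<n)
  t-involution : InvolutionOn n t
  t-involution = tr-involution 1≤x (<⇒≤ x<n) 1≤n ≤-refl
  1≤t : ∀ {i} → 1 ≤ i → i ≤ n → 1 ≤ t i
  1≤t 1≤i i≤n = proj₁ (t-involution _ 1≤i i≤n)
  t≤n : ∀ {i} → 1 ≤ i → i ≤ n → t i ≤ n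
  t≤n 1≤i i≤n = proj₁ (proj₂ (t-involution _ 1≤i i≤n))
  t∘t : ∀ {i} → 1 ≤ i → i ≤ n → t (t i) ≡ i
  t∘t 1≤i i≤n = proj₂ (proj₂ (t-involution _ 1≤i i≤n))
  surjective : ∀ v → InvolutionOn n v → v n ≡ x → Σ Fun λ w → InvolutionOn r w × Agree n (ρ w ∘ t) v
  surjective v inv vn≡x with E.surjective (v ∘ t) v∘t-involution (v∘t-fixes-x , v∘t-fixes-n)
    where
    vx≡n : v x ≡ n
    vx≡n = trans (cong v (sym vn≡x)) (proj₂ (proj₂ (inv n 1≤n ≤-refl)))
    v∘t-involution : InvolutionOn n (v ∘ t)
    v∘t-involution = ∘-involution inv t-involution (tr-commute inv (inj₂ (vx≡n , vn≡x)))
    v∘t-fixes-x : v (t x) ≡ x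
    v∘t-fixes-x = trans (cong v (tr-left x n)) vn≡x
    v∘t-fixes-n : v (t n) ≡ n
    v∘t-fixes-n = trans (cong v (tr-right x n)) vx≡n
  ... | w , inv-w , ρw≈v∘t =
        w , inv-w , λ i 1≤i i≤n →
          trans (ρw≈v∘t (t i) (1≤t 1≤i i≤n) (t≤n 1≤i i≤n)) (cong v (t∘t 1≤i i≤n))

∈-range⁻ : ∀ a b {y} → y ∈ range a b → a ≤ y × y ≤ b
∈-range⁻ a b y∈ with k , k∈ , refl ← ∈-map⁻ (a +_) y∈ =
  m≤m+n a k , subst (_≤ b) (+-comm k a) (≤-pred (m≤o∸n⇒m+n≤o (suc k) a≤1+b k<))
  where
  k< : k < suc b ∸ a
  k< = ∈-upTo⁻ k∈
  a≤1+b : a ≤ suc b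
  a≤1+b = <⇒≤ (m∸n≢0⇒n<m λ eq → n≮0 (subst (k <_) eq k<))

∈-range⁺ : ∀ {a b y} → a ≤ y → y ≤ b → y ∈ range a b
∈-range⁺ {a} {b} {y} a≤y y≤b =
  subst (_∈ range a b) (m+[n∸m]≡n a≤y) (∈-map⁺ (a +_) (∈-upTo⁺ (∸-monoˡ-< (s≤s y≤b) a≤y)))

range-unique : ∀ a b → Unique (range a b)
range-unique a b = Unique.map⁺ (+-cancelˡ-≡ a _ _) (Unique.upTo⁺ _)

record ListsAllBut (F : List ℕ) (m x : ℕ) : Set where
  field
    unique   : Unique F
    bounded  : ∀ {y} → y ∈ F → 1 ≤ y × y ≤ m
    excludes : x ∉ F
    covers   : ∀ y → 1 ≤ y → y ≤ m → y ≢ x → y ∈ F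

relabel-swapLast-slice : ∀ {F m x r} → ListsAllBut F m x → length F ≡ r → 1 ≤ x → x ≤ m →
  Slice r (suc m) x (λ w → dot2 x (suc m) (relabel F w))
relabel-swapLast-slice {F} {m} {x} lists refl 1≤x x≤m =
  swapLast-slice 1≤x (s≤s x≤m) (Embedding-restrict fixes-x-n x-n⇒outside (relabel-embedding unique bounded′))
  where
  open ListsAllBut lists
  bounded′ : ∀ {y} → y ∈ F → 1 ≤ y × y ≤ suc m
  bounded′ y∈F = proj₁ (bounded y∈F) , m≤n⇒m≤1+n (proj₂ (bounded y∈F))
  fixes-x-n : ∀ w → relabel F w x ≡ x × relabel F w (suc m) ≡ suc m
  fixes-x-n w = relabel-∉ F w excludes , relabel-∉ F w (λ n∈F → 1+n≰n (proj₂ (bounded n∈F)))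
  x-n⇒outside : ∀ {v} → InvolutionOn (suc m) v → v x ≡ x × v (suc m) ≡ suc m → FixesOutside (suc m) F v
  x-n⇒outside _ (vx≡x , vn≡n) y 1≤y y≤n y∉F with ≤-suc-cases y≤n | y ≟ x
  ... | inj₁ refl | _        = vn≡n
  ... | inj₂ _    | yes refl = vx≡x
  ... | inj₂ y≤m  | no y≢x   = ⊥-elim (y∉F (covers y 1≤y y≤m y≢x))

relabel-fixLast-slice : ∀ {F m r} → ListsAllBut F m (suc m) → length F ≡ r →
  Slice r (suc m) (suc m) (λ w → dotK (suc m) (relabel F w))
relabel-fixLast-slice {F} {m} lists refl =
  fixLast-slice (Embedding-restrict (λ _ → tt) nothing-outside (relabel-embedding unique bounded))
  where
  open ListsAllBut lists
  nothing-outside : ∀ {v} → InvolutionOn m v → ⊤ → FixesOutside m F v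
  nothing-outside _ _ y 1≤y y≤m y∉F = ⊥-elim (y∉F (covers y 1≤y y≤m (≤⇒≢suc y≤m)))

range2-lists : ∀ {m} → ListsAllBut (range 2 m) m 1
range2-lists {m} = record
  { unique   = range-unique 2 m
  ; bounded  = λ y∈ → let 2≤y , y≤m = ∈-range⁻ 2 m y∈ in <⇒≤ 2≤y , y≤m
  ; excludes = λ 1∈ → 1+n≰n (proj₁ (∈-range⁻ 2 m 1∈))
  ; covers   = λ y 1≤y y≤m y≢1 → ∈-range⁺ (≤∧≢⇒< 1≤y (y≢1 ∘ sym)) y≤m
  }

rotated-lists : ∀ {m} → 1 ≤ m → ListsAllBut (range 2 m ++ [ 1 ]) m (suc m)
rotated-lists {m} 1≤m = record
  { unique   = Unique.++⁺ (range-unique 2 m) ([] ∷ []) λ { (1∈ , here refl) → 1+n≰n (proj₁ (∈-range⁻ 2 m 1∈)) }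
  ; bounded  = bounded
  ; excludes = λ 1+m∈ → 1+n≰n (proj₂ (bounded 1+m∈))
  ; covers   = λ y 1≤y y≤m _ → case y ≟ 1 of λ where
                 (yes refl) → ∈-++⁺ʳ (range 2 m) (here refl)
                 (no y≢1)   → ∈-++⁺ˡ (∈-range⁺ (≤∧≢⇒< 1≤y (y≢1 ∘ sym)) y≤m)
  }
  where
  bounded : ∀ {y} → y ∈ range 2 m ++ [ 1 ] → 1 ≤ y × y ≤ m
  bounded y∈ with ∈-++⁻ (range 2 m) y∈
  ... | inj₁ y∈range = let 2≤y , y≤m = ∈-range⁻ 2 m y∈range in <⇒≤ 2≤y , y≤m
  ... | inj₂ (here refl) = ≤-refl , 1≤m

length-rotated : ∀ {m} → 1 ≤ m → length (range 2 m ++ [ 1 ]) ≡ m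
length-rotated {suc m} _ = begin
  length (range 2 (suc m) ++ [ 1 ])  ≡⟨ length-++ (range 2 (suc m)) ⟩
  length (range 2 (suc m)) + 1       ≡⟨ cong (_+ 1) (length-range 2 (suc m)) ⟩
  m + 1                              ≡⟨ +-comm m 1 ⟩
  suc m                              ∎
  where open ≡-Reasoning

-- The lists G_i (c = p+1, x = p) and H_i (c = p, x = p+1) of the definition of GCA(m+1).
block-lists : ∀ {m p c x} → 1 ≤ p → suc p ≤ m → (c ≡ p × x ≡ suc p) ⊎ (c ≡ suc p × x ≡ p) →
  ListsAllBut (c ∷ (range 1 (p ∸ 1) ++ range (p + 2) m)) m x
block-lists {m} {suc q} {c} {x} (s≤s z≤n) p<m c,x = record
  { unique   = All.tabulate (λ c∈ c≡ → c∉tail (subst (_∈ tail) (sym c≡) c∈))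
               ∷ Unique.++⁺ (range-unique 1 q) (range-unique (suc q + 2) m)
                   (λ { (y∈low , y∈high) →
                        1+n≰n (≤-trans (proj₂ (low y∈low)) (≤-trans (m≤n⇒m≤1+n (n≤1+n p)) (high y∈high))) })
  ; bounded  = bounded
  ; excludes = λ where
                 (here x≡c) → c≢x c,x (sym x≡c)
                 (there x∈) → x∉tail x∈
  ; covers   = covers
  }
  where
  p : ℕ
  p = suc q
  tail : List ℕ
  tail = range 1 q ++ range (p + 2) m
  low : ∀ {y} → y ∈ range 1 q → 1 ≤ y × y < p
  low y∈ = let 1≤y , y≤q = ∈-range⁻ 1 q y∈ in 1≤y , s≤s y≤q
  high : ∀ {y} → y ∈ range (p + 2) m → suc (suc p) ≤ y
  high {y} y∈ = subst (_≤ y) (+-comm p 2) (proj₁ (∈-range⁻ (p + 2) m y∈))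
  in-pair : ∀ {y} → p ≤ y → y ≤ suc p → y ∉ tail
  in-pair p≤y y≤1+p y∈ with ∈-++⁻ (range 1 q) y∈
  ... | inj₁ y∈low  = 1+n≰n (≤-trans (proj₂ (low y∈low)) p≤y)
  ... | inj₂ y∈high = 1+n≰n (≤-trans (high y∈high) y≤1+p)
  Pair : Set
  Pair = (c ≡ p × x ≡ suc p) ⊎ (c ≡ suc p × x ≡ p)
  c-bounds : Pair → p ≤ c × c ≤ suc p
  c-bounds (inj₁ (refl , _)) = ≤-refl , n≤1+n p
  c-bounds (inj₂ (refl , _)) = n≤1+n p , ≤-refl
  x-bounds : Pair → p ≤ x × x ≤ suc p
  x-bounds (inj₁ (_ , refl)) = n≤1+n p , ≤-refl
  x-bounds (inj₂ (_ , refl)) = ≤-refl , n≤1+n p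
  c≢x : Pair → c ≢ x
  c≢x (inj₁ (refl , refl)) = 1+n≢n ∘ sym
  c≢x (inj₂ (refl , refl)) = 1+n≢n
  only-c : Pair → ∀ {y} → p ≤ y → y ≤ suc p → y ≢ x → y ≡ c
  only-c (inj₁ (refl , refl)) p≤y y≤1+p y≢x with ≤-suc-cases y≤1+p
  ... | inj₁ y≡1+p = ⊥-elim (y≢x y≡1+p)
  ... | inj₂ y≤p   = ≤-antisym y≤p p≤y
  only-c (inj₂ (refl , refl)) p≤y y≤1+p y≢x with ≤-suc-cases y≤1+p
  ... | inj₁ y≡1+p = y≡1+p
  ... | inj₂ y≤p   = ⊥-elim (y≢x (≤-antisym y≤p p≤y))
  c∉tail : c ∉ tail
  c∉tail = in-pair (proj₁ (c-bounds c,x)) (proj₂ (c-bounds c,x))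
  x∉tail : x ∉ tail
  x∉tail = in-pair (proj₁ (x-bounds c,x)) (proj₂ (x-bounds c,x))
  bounded : ∀ {y} → y ∈ c ∷ tail → 1 ≤ y × y ≤ m
  bounded (here refl) = ≤-trans (s≤s z≤n) (proj₁ (c-bounds c,x)) , ≤-trans (proj₂ (c-bounds c,x)) p<m
  bounded (there y∈) with ∈-++⁻ (range 1 q) y∈
  ... | inj₁ y∈low  = proj₁ (low y∈low) , ≤-trans (<⇒≤ (proj₂ (low y∈low))) (<⇒≤ p<m)
  ... | inj₂ y∈high = ≤-trans (s≤s z≤n) (high y∈high) , proj₂ (∈-range⁻ (p + 2) m y∈high)
  covers : ∀ y → 1 ≤ y → y ≤ m → y ≢ x → y ∈ c ∷ tail
  covers y 1≤y y≤m y≢x with y ≤? q | y ≤? suc p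
  ... | yes y≤q | _         = there (∈-++⁺ˡ (∈-range⁺ 1≤y y≤q))
  ... | no y≰q  | yes y≤1+p = here (only-c c,x (≰⇒> y≰q) y≤1+p y≢x)
  ... | no _    | no y≰1+p  = there (∈-++⁺ʳ (range 1 q) (∈-range⁺ (subst (_≤ y) (+-comm 2 p) (≰⇒> y≰1+p)) y≤m))

length-block : ∀ {m p} c → 1 ≤ p → suc p ≤ m → length (c ∷ (range 1 (p ∸ 1) ++ range (p + 2) m)) ≡ m ∸ 1
length-block {suc m} {suc q} c _ (s≤s p≤m) = suc-injective (begin
  suc (suc (length (range 1 q ++ range (suc q + 2) (suc m))))
    ≡⟨ cong (suc ∘ suc) (length-++ (range 1 q)) ⟩
  suc (suc (length (range 1 q) + length (range (suc q + 2) (suc m))))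
    ≡⟨ cong₂ (λ a b → suc (suc (a + b))) (length-range 1 q) (length-range (suc q + 2) (suc m)) ⟩
  suc (suc q) + (suc m ∸ (q + 2))
    ≡⟨ cong (λ d → suc (suc q) + (suc m ∸ d)) (+-comm q 2) ⟩
  suc (suc q) + (suc m ∸ suc (suc q))
    ≡⟨ m+[n∸m]≡n (s≤s p≤m) ⟩
  suc m ∎)
  where open ≡-Reasoning

-- The blocks of GCA(n)

-- GCA(n-2)^{G_i}·(p n) followed by the reversal of GCA(n-2)^{H_i}·(p+1 n), for p = 2i-1 or p = 2i.
pairBlock : ℕ → List Fun → ℕ → List Fun
pairBlock n B p =
  map (dot2 p n ∘ relabel (suc p ∷ others)) B ++ reverse (map (dot2 (suc p) n ∘ relabel (p ∷ others)) B)
  where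
  others : List ℕ
  others = range 1 (p ∸ 1) ++ range (p + 2) (n ∸ 1)

pairBlock-segment : ∀ {k B p} → 1 ≤ p → suc p ≤ 4 + k → GrayCode (3 + k) B →
  Segment (5 + k) (λ z → p ≤ z × z < 2 + p) (pairBlock (5 + k) B p) (tr p (5 + k)) (tr (suc p) (5 + k))
pairBlock-segment {k} {p = p} 1≤p p<m segB =
  Segment-values (s≤s z≤n) pair⇒range range⇒pair
    (Segment-++ (s≤s z≤n) (λ { _ refl → 1+n≢n ∘ sym }) junction
      (Segment-endpoints (starts-at G-lists) Agree-refl
        (Segment-map (relabel-swapLast-slice G-lists G-length 1≤p (<⇒≤ p<m)) segB))
      (Segment-reverse (Segment-endpoints (starts-at H-lists) Agree-refl
        (Segment-map (relabel-swapLast-slice H-lists H-length (s≤s z≤n) p<m) segB))))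
  where
  n : ℕ
  n = 5 + k
  others : List ℕ
  others = range 1 (p ∸ 1) ++ range (p + 2) (4 + k)
  G : List ℕ
  G = suc p ∷ others
  H : List ℕ
  H = p ∷ others
  G-lists : ListsAllBut G (4 + k) p
  G-lists = block-lists 1≤p p<m (inj₂ (refl , refl))
  H-lists : ListsAllBut H (4 + k) (suc p)
  H-lists = block-lists 1≤p p<m (inj₁ (refl , refl))
  G-length : length G ≡ 3 + k
  G-length = length-block (suc p) 1≤p p<m
  H-length : length H ≡ 3 + k
  H-length = length-block p 1≤p p<m
  -- the last entry of B only moves positions 2+k and 3+k, which lie in the tail shared by G and H
  ends-agree : ∀ {c x} → ListsAllBut (c ∷ others) (4 + k) x → length (c ∷ others) ≡ 3 + k →
    Agree n (tr (at others (suc k)) (at others (2 + k)) ∘ tr x n) (dot2 x n (relabel (c ∷ others) (tr (2 + k) (3 + k))))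
  ends-agree {x = x} lists len i _ _ =
    sym (relabel-tr (ListsAllBut.unique lists) (s≤s z≤n) (subst (2 + k ≤_) (sym len) (n≤1+n _))
                                               (s≤s z≤n) (subst (3 + k ≤_) (sym len) ≤-refl) (tr x n i))
  starts-at : ∀ {F x} → ListsAllBut F (4 + k) x → Agree n (dot2 x n (relabel F idF)) (tr x n)
  starts-at lists i _ _ = relabel-id (ListsAllBut.unique lists) (tr _ n i)
  junction : StepF n (dot2 p n (relabel G (tr (2 + k) (3 + k)))) (dot2 (suc p) n (relabel H (tr (2 + k) (3 + k))))
  junction = StepF-cong (ends-agree G-lists G-length) (ends-agree H-lists H-length)
    (rotate-step (tr (at others (suc k)) (at others (2 + k))) 1≤p p≤n (s≤s z≤n) 1+p≤n (s≤s z≤n) ≤-refl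
      (1+n≢n ∘ sym) (<⇒≢ 1+p≤n) (<⇒≢ (s≤s p<m)))
    where
    1+p≤n : suc p ≤ n
    1+p≤n = m≤n⇒m≤1+n p<m
    p≤n : p ≤ n
    p≤n = <⇒≤ 1+p≤n
  pair⇒range : ∀ z → z ≡ p ⊎ z ≡ suc p → p ≤ z × z < 2 + p
  pair⇒range z (inj₁ refl) = ≤-refl , s≤s (n≤1+n z)
  pair⇒range z (inj₂ refl) = n≤1+n p , ≤-refl
  range⇒pair : ∀ z → 1 ≤ z → z ≤ n → p ≤ z × z < 2 + p → z ≡ p ⊎ z ≡ suc p
  range⇒pair z _ _ (p≤z , z<2+p) with ≤-suc-cases (≤-pred z<2+p)
  ... | inj₁ z≡1+p = inj₂ z≡1+p
  ... | inj₂ z≤p   = inj₁ (≤-antisym z≤p p≤z)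

pairChain : ℕ → List Fun → ℕ → ℕ → List Fun
pairChain n B p zero    = []
pairChain n B p (suc K) = pairBlock n B p ++ pairChain n B (2 + p) K

2*suc-shift : ∀ a p → 2 * a + (2 + p) ≡ 2 * suc a + p
2*suc-shift a p = begin
  2 * a + (2 + p)    ≡⟨ +-suc (2 * a) (suc p) ⟩
  suc (2 * a + suc p) ≡⟨ cong suc (+-suc (2 * a) p) ⟩
  2 + (2 * a + p)    ≡⟨ cong (_+ p) (*-suc 2 a) ⟨
  2 * suc a + p      ∎
  where open ≡-Reasoning

pairChain-segment : ∀ {k B} K {p} → 1 ≤ p → 2 * suc K + p ≤ 5 + k → GrayCode (3 + k) B →
  Segment (5 + k) (λ z → p ≤ z × z < 2 * suc K + p) (pairChain (5 + k) B p (suc K))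
    (tr p (5 + k)) (tr (suc (2 * K + p)) (5 + k))
pairChain-segment {k} {B} zero {p} 1≤p bound segB =
  subst (λ L → Segment (5 + k) _ L _ _) (sym (++-identityʳ (pairBlock (5 + k) B p)))
    (pairBlock-segment 1≤p (≤-pred bound) segB)
pairChain-segment {k} {B} (suc K) {p} 1≤p bound segB =
  Segment-values (s≤s z≤n) union⇒range range⇒union
    (subst (λ q → Segment (5 + k) Union (pairChain (5 + k) B p (2 + K)) (tr p (5 + k)) (tr (suc q) (5 + k))) (2*suc-shift K p)
      (Segment-++ (s≤s z≤n) (λ _ (_ , z<2+p) (2+p≤z , _) → <⇒≱ z<2+p 2+p≤z) junction
        (pairBlock-segment 1≤p 1+p<5+k segB)
        (pairChain-segment K (s≤s z≤n) (subst (_≤ 5 + k) (sym (2*suc-shift (suc K) p)) bound) segB)))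
  where
  Union : ℕ → Set
  Union z = (p ≤ z × z < 2 + p) ⊎ (2 + p ≤ z × z < 2 * suc K + (2 + p))
  4+p≤ : 4 + p ≤ 2 * suc (suc K) + p
  4+p≤ = +-monoˡ-≤ p (*-monoʳ-≤ 2 (s≤s (s≤s z≤n)))
  2+p≤ : 2 + p ≤ 2 * suc (suc K) + p
  2+p≤ = ≤-trans (m≤n+m (2 + p) 2) 4+p≤
  1+p<5+k : suc p ≤ 4 + k
  1+p<5+k = ≤-pred (≤-trans 2+p≤ bound)
  junction : StepF (5 + k) (tr (suc p) (5 + k)) (tr (2 + p) (5 + k))
  junction = rotate-step idF (s≤s z≤n) (m≤n⇒m≤1+n 1+p<5+k) (s≤s z≤n) (≤-trans 2+p≤ bound) (s≤s z≤n) ≤-refl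
               (1+n≢n ∘ sym) (<⇒≢ (s≤s 1+p<5+k)) (<⇒≢ (≤-trans (n≤1+n (3 + p)) (≤-trans 4+p≤ bound)))
  union⇒range : ∀ z → Union z → p ≤ z × z < 2 * suc (suc K) + p
  union⇒range z (inj₁ (p≤z , z<2+p)) = p≤z , <-≤-trans z<2+p 2+p≤
  union⇒range z (inj₂ (2+p≤z , z<)) = ≤-trans (m≤n+m p 2) 2+p≤z , subst (z <_) (2*suc-shift (suc K) p) z<
  range⇒union : ∀ z → 1 ≤ z → z ≤ 5 + k → p ≤ z × z < 2 * suc (suc K) + p → Union z
  range⇒union z _ _ (p≤z , z<) with z <? 2 + p
  ... | yes z<2+p = inj₁ (p≤z , z<2+p)
  ... | no  z≮2+p = inj₂ (≮⇒≥ z≮2+p , subst (z <_) (sym (2*suc-shift (suc K) p)) z<)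

pairBlock-≡ : ∀ n B {p x₁ c₁ x₂ c₂ a b} →
  x₁ ≡ p → c₁ ≡ suc p → x₂ ≡ suc p → c₂ ≡ p → a ≡ p ∸ 1 → b ≡ p + 2 →
  map (dot2 x₁ n ∘ relabel (c₁ ∷ (range 1 a ++ range b (n ∸ 1)))) B
    ++ reverse (map (dot2 x₂ n ∘ relabel (c₂ ∷ (range 1 a ++ range b (n ∸ 1)))) B)
  ≡ pairBlock n B p
pairBlock-≡ n B refl refl refl refl refl refl = refl

concatMap-pairChain : ∀ n B (block : ℕ → List Fun) (f : ℕ → ℕ) K p →
  (∀ i → block (f i) ≡ pairBlock n B (p + 2 * i)) → concatMap block (applyUpTo f K) ≡ pairChain n B p K
concatMap-pairChain n B block f zero    p block≡ = refl
concatMap-pairChain n B block f (suc K) p block≡ =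
  cong₂ _++_ (trans (block≡ 0) (cong (pairBlock n B) (+-identityʳ p)))
    (concatMap-pairChain n B block (f ∘ suc) K (2 + p)
      λ i → trans (block≡ (suc i)) (cong (pairBlock n B) (begin
        p + 2 * suc i    ≡⟨ +-comm p _ ⟩
        2 * suc i + p    ≡⟨ 2*suc-shift i p ⟨
        2 * i + (2 + p)  ≡⟨ +-comm (2 * i) _ ⟩
        2 + p + 2 * i    ∎)))
  where open ≡-Reasoning

-- copies of the local blocks of Defs.oddStep and Defs.evenStep
oddBlock evenBlock : ℕ → List Fun → ℕ → List Fun
oddBlock n B i =
  map (dot2 (2 * i ∸ 1) n ∘ relabel ((2 * i) ∷ (range 1 (2 * i ∸ 2) ++ range (2 * i + 1) (n ∸ 1)))) B
  ++ reverse (map (dot2 (2 * i) n ∘ relabel ((2 * i ∸ 1) ∷ (range 1 (2 * i ∸ 2) ++ range (2 * i + 1) (n ∸ 1)))) B)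
evenBlock n B i =
  map (dot2 (2 * i) n ∘ relabel ((2 * i + 1) ∷ (range 1 (2 * i ∸ 1) ++ range (2 * i + 2) (n ∸ 1)))) B
  ++ reverse (map (dot2 (2 * i + 1) n ∘ relabel ((2 * i) ∷ (range 1 (2 * i ∸ 1) ++ range (2 * i + 2) (n ∸ 1)))) B)

oddStep-pairChain : ∀ n A B → oddStep n A B ≡
  map (dotK n ∘ relabel (range 2 (n ∸ 1) ++ [ 1 ])) A ++ pairChain n B 1 ⌊ n /2⌋
oddStep-pairChain n A B = cong (map (dotK n ∘ relabel (range 2 (n ∸ 1) ++ [ 1 ])) A ++_) (begin
  concatMap (oddBlock n B) (map suc (upTo K))  ≡⟨ cong (concatMap (oddBlock n B)) (map-applyUpTo id suc K) ⟩
  concatMap (oddBlock n B) (applyUpTo suc K)   ≡⟨ concatMap-pairChain n B (oddBlock n B) suc K 1 block≡ ⟩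
  pairChain n B 1 K                            ∎)
  where
  open ≡-Reasoning
  K : ℕ
  K = ⌊ n /2⌋
  block≡ : ∀ i → oddBlock n B (suc i) ≡ pairBlock n B (1 + 2 * i)
  block≡ i = pairBlock-≡ n B (cong (_∸ 1) 2i+2) 2i+2 2i+2 (cong (_∸ 1) 2i+2) (cong (_∸ 2) 2i+2)
               (trans (cong (_+ 1) 2i+2) (cong suc (sym (+-suc (2 * i) 1))))
    where
    2i+2 : 2 * suc i ≡ 2 + 2 * i
    2i+2 = *-suc 2 i

evenStep-pairChain : ∀ n A B → evenStep n A B ≡
  map (dotK n) A ++ reverse (map (dot2 1 n ∘ relabel (range 2 (n ∸ 1))) B) ++ pairChain n B 2 (⌊ n /2⌋ ∸ 1)
evenStep-pairChain n A B =
  cong (λ blocks → map (dotK n) A ++ reverse (map (dot2 1 n ∘ relabel (range 2 (n ∸ 1))) B) ++ blocks) (begin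
  concatMap (evenBlock n B) (map suc (upTo K))  ≡⟨ cong (concatMap (evenBlock n B)) (map-applyUpTo id suc K) ⟩
  concatMap (evenBlock n B) (applyUpTo suc K)   ≡⟨ concatMap-pairChain n B (evenBlock n B) suc K 2 block≡ ⟩
  pairChain n B 2 K                             ∎)
  where
  open ≡-Reasoning
  K : ℕ
  K = ⌊ n /2⌋ ∸ 1
  block≡ : ∀ i → evenBlock n B (suc i) ≡ pairBlock n B (2 + 2 * i)
  block≡ i = pairBlock-≡ n B 2i+2 2i+3 2i+3 2i+2 (cong (_∸ 1) 2i+2) (cong (_+ 2) 2i+2)
    where
    2i+2 : 2 * suc i ≡ 2 + 2 * i
    2i+2 = *-suc 2 i
    2i+3 : 2 * suc i + 1 ≡ 3 + 2 * i
    2i+3 = trans (cong (_+ 1) 2i+2) (cong (suc ∘ suc) (+-comm (2 * i) 1))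

finalPairChain-segment : ∀ {k B K p} → 1 ≤ p → 2 * suc K + p ≡ 5 + k → GrayCode (3 + k) B →
  Segment (5 + k) (λ z → p ≤ z × z < 5 + k) (pairChain (5 + k) B p (suc K)) (tr p (5 + k)) (tr (4 + k) (5 + k))
finalPairChain-segment {k} {B} {K} {p} 1≤p top segB =
  subst₂ (λ b q → Segment (5 + k) (λ z → p ≤ z × z < b) (pairChain (5 + k) B p (suc K)) (tr p (5 + k)) (tr q (5 + k)))
    top (suc-injective (trans (cong (λ a → a + p) (sym (*-suc 2 K))) top))
    (pairChain-segment K 1≤p (≤-reflexive top) segB)

oddStep-segment : ∀ {k A B} → 2 * ⌊ 5 + k /2⌋ + 1 ≡ 5 + k → GrayCode (4 + k) A → GrayCode (3 + k) B →
  GrayCode (5 + k) (oddStep (5 + k) A B)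
oddStep-segment {k} {A} {B} top segA segB =
  subst (GrayCode n) (sym (oddStep-pairChain n A B))
    (Segment-values (s≤s z≤n) (λ _ _ → tt) top-or-below
      (Segment-++ (s≤s z≤n) (λ { _ refl (_ , n<n) → <-irrefl refl n<n }) junction
        (Segment-endpoints starts-id ends-agree
          (Segment-map (relabel-fixLast-slice (rotated-lists (s≤s z≤n)) |F₀|) segA))
        (finalPairChain-segment ≤-refl top segB)))
  where
  n : ℕ
  n = 5 + k
  F₀ : List ℕ
  F₀ = range 2 (4 + k) ++ [ 1 ]
  F₀-unique : Unique F₀
  F₀-unique = ListsAllBut.unique (rotated-lists {4 + k} (s≤s z≤n))
  |F₀| : length F₀ ≡ 4 + k
  |F₀| = length-rotated (s≤s z≤n)
  |range| : length (range 2 (4 + k)) ≡ 3 + k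
  |range| = length-range 2 (4 + k)
  F₀-penultimate : at F₀ (3 + k) ≡ 4 + k
  F₀-penultimate = trans (at-++ˡ (range 2 (4 + k)) [ 1 ] (3 + k) (s≤s z≤n) (≤-reflexive (sym |range|)))
                         (at-range 2 (4 + k) (3 + k) (s≤s z≤n) ≤-refl)
  F₀-last : at F₀ (4 + k) ≡ 1
  F₀-last = subst (λ i → at F₀ i ≡ 1) (trans (cong (_+ 1) |range|) (cong (3 +_) (+-comm k 1)))
                  (at-++ʳ (range 2 (4 + k)) [ 1 ] 1 ≤-refl)
  starts-id : Agree n (dotK n (relabel F₀ idF)) idF
  starts-id i _ _ = trans (dotK-fixed (relabel F₀ idF) (relabel-id F₀-unique n) i) (relabel-id F₀-unique i)
  ends-agree : Agree n (dotK n (relabel F₀ (tr (3 + k) (4 + k)))) (tr (4 + k) 1)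
  ends-agree i _ _ with i ≟ n
  ... | yes refl = trans (dotK-self n (relabel F₀ (tr (3 + k) (4 + k)))) (sym (tr-other 1+n≢n (λ ())))
  ... | no i≢n   = begin
    dotK n (relabel F₀ (tr (3 + k) (4 + k))) i ≡⟨ dotK-other (relabel F₀ (tr (3 + k) (4 + k))) i≢n ⟩
    relabel F₀ (tr (3 + k) (4 + k)) i         ≡⟨ relabel-tr F₀-unique (s≤s z≤n) (≤-trans (n≤1+n (3 + k)) 4+k≤)
                                                                  (s≤s z≤n) 4+k≤ i ⟩
    tr (at F₀ (3 + k)) (at F₀ (4 + k)) i      ≡⟨ cong₂ (λ a b → tr a b i) F₀-penultimate F₀-last ⟩
    tr (4 + k) 1 i                            ∎
    where
    open ≡-Reasoning
    4+k≤ : 4 + k ≤ length F₀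
    4+k≤ = ≤-reflexive (sym |F₀|)
  junction : StepF n (tr (4 + k) 1) (tr 1 n)
  junction = StepF-cong Agree-refl (λ i _ _ → tr-comm n 1 i)
    (rotate-step idF (s≤s z≤n) (n≤1+n _) (s≤s z≤n) ≤-refl ≤-refl (s≤s z≤n) (1+n≢n ∘ sym) (λ ()) (λ ()))
  top-or-below : ∀ z → 1 ≤ z → z ≤ n → ⊤ → z ≡ n ⊎ (1 ≤ z × z < n)
  top-or-below z 1≤z z≤top _ = Sum.map₂ (λ z<top → 1≤z , s≤s z<top) (≤-suc-cases z≤top)

evenStep-segment : ∀ {k A B} → 2 * ⌊ 5 + k /2⌋ ≡ 5 + k → GrayCode (4 + k) A → GrayCode (3 + k) B →
  GrayCode (5 + k) (evenStep (5 + k) A B)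
evenStep-segment {k} {A} {B} top segA segB =
  subst (GrayCode n) (sym (evenStep-pairChain n A B))
    (Segment-values (s≤s z≤n) (λ _ _ → tt) classify
      (Segment-++ (s≤s z≤n) (λ { _ refl (inj₂ (_ , n<n)) → <-irrefl refl n<n }) junction-A
        (Segment-endpoints (λ i _ _ → dotK-fixed idF refl i)
                           (λ i _ _ → dotK-fixed (tr (3 + k) (4 + k)) (tr-other (>⇒≢ (n≤1+n (4 + k))) 1+n≢n) i)
          (Segment-map (fixLast-slice id-embedding) segA))
        (Segment-++ (s≤s z≤n) (λ { _ refl (2≤1 , _) → 1+n≰n 2≤1 }) junction-B
          (Segment-reverse (Segment-endpoints starts-B ends-B
            (Segment-map (relabel-swapLast-slice range2-lists |F| ≤-refl (s≤s z≤n)) segB)))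
          (finalPairChain-segment (s≤s z≤n) top′ segB))))
  where
  n : ℕ
  n = 5 + k
  K : ℕ
  K = ⌊ 1 + k /2⌋
  top′ : 2 * suc K + 2 ≡ n
  top′ = trans (+-comm (2 * suc K) 2) (trans (sym (*-suc 2 (suc K))) top)
  F : List ℕ
  F = range 2 (4 + k)
  F-unique : Unique F
  F-unique = ListsAllBut.unique (range2-lists {4 + k})
  |F| : length F ≡ 3 + k
  |F| = length-range 2 (4 + k)
  starts-B : Agree n (dot2 1 n (relabel F idF)) (tr 1 n)
  starts-B i _ _ = relabel-id F-unique (tr 1 n i)
  ends-B : Agree n (dot2 1 n (relabel F (tr (2 + k) (3 + k)))) (tr (3 + k) (4 + k) ∘ tr 1 n)
  ends-B i _ _ = trans (relabel-tr F-unique (s≤s z≤n) (≤-trans (n≤1+n (2 + k)) (≤-reflexive (sym |F|)))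
                                           (s≤s z≤n) (≤-reflexive (sym |F|)) (tr 1 n i))
                       (cong₂ (λ a b → tr a b (tr 1 n i)) (at-range 2 (4 + k) (2 + k) (s≤s z≤n) (n≤1+n (2 + k)))
                                                         (at-range 2 (4 + k) (3 + k) (s≤s z≤n) ≤-refl))
  junction-A : StepF n (tr (3 + k) (4 + k)) (tr (3 + k) (4 + k) ∘ tr 1 n)
  junction-A = swap-step (tr (3 + k) (4 + k)) ≤-refl (s≤s z≤n) (s≤s z≤n) ≤-refl (λ ())
  junction-B : StepF n (tr 1 n) (tr 2 n)
  junction-B = rotate-step idF ≤-refl (s≤s z≤n) (s≤s z≤n) (s≤s (s≤s z≤n)) (s≤s z≤n) ≤-refl
                 (λ ()) (λ ()) (λ ())
  classify : ∀ z → 1 ≤ z → z ≤ n → ⊤ → z ≡ n ⊎ (z ≡ 1 ⊎ (2 ≤ z × z < n))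
  classify z 1≤z z≤top _ with ≤-suc-cases z≤top | z ≟ 1
  ... | inj₁ z≡n   | _        = inj₁ z≡n
  ... | inj₂ _     | yes z≡1  = inj₂ (inj₁ z≡1)
  ... | inj₂ z<top | no z≢1   = inj₂ (inj₂ (≤∧≢⇒< 1≤z (z≢1 ∘ sym) , s≤s z<top))

isEven-half : ∀ n → isEven n ≡ true → 2 * ⌊ n /2⌋ ≡ n
isEven-half zero          _      = refl
isEven-half (suc (suc n)) even-n = trans (*-suc 2 ⌊ n /2⌋) (cong (2 +_) (isEven-half n even-n))

isOdd-half : ∀ n → isEven n ≡ false → 2 * ⌊ n /2⌋ + 1 ≡ n
isOdd-half (suc zero)    _     = refl
isOdd-half (suc (suc n)) odd-n = trans (cong (_+ 1) (*-suc 2 ⌊ n /2⌋)) (cong (2 +_) (isOdd-half n odd-n))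

gca-segment : ∀ k → GrayCode (4 + k) (gca (4 + k)) → GrayCode (3 + k) (gca (3 + k)) → GrayCode (5 + k) (gca (5 + k))
gca-segment k segA segB with isEven (suc k) in parity
... | true  = evenStep-segment (isEven-half (5 + k) parity) segA segB
... | false = oddStep-segment (isOdd-half (5 + k) parity) segA segB

-- Back to one-line notation

lastTransp-oneLine : ∀ s → lastTransp (2 + s) ≡ oneLine (2 + s) (tr (1 + s) (2 + s))
lastTransp-oneLine s = at-ext (2 + s) _ _ |lastTransp| (length-oneLine (2 + s) _)
  λ i 1≤i i≤2+s → trans (entry i 1≤i i≤2+s) (sym (at-oneLine (2 + s) (tr (1 + s) (2 + s)) i 1≤i i≤2+s))
  where
  R : List ℕ
  R = range 1 s
  |R| : length R ≡ s
  |R| = length-range 1 s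
  |lastTransp| : length (lastTransp (2 + s)) ≡ 2 + s
  |lastTransp| = trans (length-++ R) (trans (+-comm (length R) 2) (cong (2 +_) |R|))
  at-end : ∀ j → 1 ≤ j → at (lastTransp (2 + s)) (j + s) ≡ at (suc (suc s) ∷ suc s ∷ []) j
  at-end j 1≤j = trans (cong (at (lastTransp (2 + s))) (trans (+-comm j s) (cong (_+ j) (sym |R|)))) (at-++ʳ R _ j 1≤j)
  entry : ∀ i → 1 ≤ i → i ≤ 2 + s → at (lastTransp (2 + s)) i ≡ tr (1 + s) (2 + s) i
  entry i 1≤i i≤2+s with ≤-suc-cases i≤2+s
  ... | inj₁ refl = trans (at-end 2 (s≤s z≤n)) (sym (tr-right (1 + s) (2 + s)))
  ... | inj₂ i≤1+s with ≤-suc-cases i≤1+s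
  ...   | inj₁ refl = trans (at-end 1 ≤-refl) (sym (tr-left (1 + s) (2 + s)))
  ...   | inj₂ i≤s  = trans (at-++ˡ R _ i 1≤i (subst (i ≤_) (sym |R|) i≤s))
                        (trans (at-range1 s i 1≤i i≤s)
                          (sym (tr-other (<⇒≢ (s≤s i≤s)) (<⇒≢ (s≤s (m≤n⇒m≤1+n i≤s))))))

identity-oneLine : ∀ m → identity m ≡ oneLine m idF
identity-oneLine m = sym (map-id (range 1 m))

module _ {s : ℕ} {L : List Fun} where

  private
    m : ℕ
    m = 2 + s
    P : List (List ℕ)
    P = map (oneLine m) L

  endpoint⁺ : ∀ {u mw} → Maybe.Any (Agree m u) mw → Data.Maybe.map (oneLine m) mw ≡ just (oneLine m u)
  endpoint⁺ (just u≈w) = cong just (oneLine-cong (Agree-sym u≈w))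

  endpoint⁻ : ∀ {u} mw → Data.Maybe.map (oneLine m) mw ≡ just (oneLine m u) → Maybe.Any (Agree m u) mw
  endpoint⁻ (just w) eq = just (oneLine-injective (sym (just-injective eq)))

  GrayCode⇐GCA : ContainsEachInvolutionOnce m P → A1 m P → A2 m P → GrayCode m L
  GrayCode⇐GCA (invs , unique , complete) (first , final) a2 = record
    { involutions = All.map (λ {w} inv → InvolutionOn-cong (at-oneLine m w) (proj₂ inv)) (All.map⁻ invs)
    ; distinct    = AllPairs.map (λ w≢w′ w≈w′ → w≢w′ (oneLine-cong w≈w′)) (AllPairs.map⁻ unique)
    ; steps       = Adjacent-map⁻ (oneLine m) (StepF-cong (at-oneLine m _) (at-oneLine m _)) L a2
    ; values      = All.universal (λ _ → tt) L
    ; complete    = λ v inv _ → Any.map (oneLine-injective {m})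
                                  (Any.map⁻ (complete (oneLine m v) (InvolutionOn⇒IsInvolution inv)))
    ; starts      = endpoint⁻ (head L) (trans (sym (head-map L)) (trans first (cong just (identity-oneLine m))))
    ; ends        = endpoint⁻ (last L) (trans (sym (last-map (oneLine m) L)) (trans final (cong just (lastTransp-oneLine s))))
    }

  GrayCode⇒GCA : GrayCode m L → ContainsEachInvolutionOnce m P × A1 m P × A2 m P × Cyclic m P
  GrayCode⇒GCA code =
    ( All.map⁺ (All.map InvolutionOn⇒IsInvolution involutions)
    , AllPairs.map⁺ (AllPairs.map (λ w≉w′ eq → w≉w′ (oneLine-injective eq)) distinct)
    , λ p (|p| , inv) →
        Any.map⁺ (Any.map (λ p≈w → trans (sym (oneLine-at |p|)) (oneLine-cong p≈w)) (complete (at p) inv tt)) )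
    , (first , final)
    , Adjacent-map⁺ (oneLine m) (StepF-cong (Agree-sym (at-oneLine m _)) (Agree-sym (at-oneLine m _))) L steps
    , lastTransp m , identity m , final , first , wrap-around
    where
    open Segment code
    first : head P ≡ just (identity m)
    first = trans (head-map L) (trans (endpoint⁺ starts) (cong just (sym (identity-oneLine m))))
    final : last P ≡ just (lastTransp m)
    final = trans (last-map (oneLine m) L) (trans (endpoint⁺ ends) (cong just (sym (lastTransp-oneLine s))))
    wrap-around : Step m (lastTransp m) (identity m)
    wrap-around = subst₂ (Step m) (sym (lastTransp-oneLine s)) (sym (identity-oneLine m))
      (StepF-cong (Agree-sym (at-oneLine m _)) (Agree-sym (at-oneLine m idF))
        (StepF-sym (swap-step idF (s≤s z≤n) (n≤1+n (1 + s)) (s≤s z≤n) ≤-refl (1+n≢n ∘ sym))))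

theorem3p2 : (n : ℕ) → 5 ≤ n →
    ContainsEachInvolutionOnce (n ∸ 2) (GCA (n ∸ 2)) → A1 (n ∸ 2) (GCA (n ∸ 2)) → A2 (n ∸ 2) (GCA (n ∸ 2)) →
    ContainsEachInvolutionOnce (n ∸ 1) (GCA (n ∸ 1)) → A1 (n ∸ 1) (GCA (n ∸ 1)) → A2 (n ∸ 1) (GCA (n ∸ 1)) →
    ContainsEachInvolutionOnce n (GCA n) × A1 n (GCA n) × A2 n (GCA n) × Cyclic n (GCA n)
theorem3p2 (suc (suc (suc (suc (suc k))))) _ once₂ a1₂ a2₂ once₁ a1₁ a2₁ =
  GrayCode⇒GCA (gca-segment k (GrayCode⇐GCA once₁ a1₁ a2₁) (GrayCode⇐GCA once₂ a1₂ a2₂))
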